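{- Let $\varphi_P$ be the linear functional on $R$ with $\varphi_P(s_v)=d(v)/|v|!$ for all $v\in\mathbb{YF}$. Then $\varphi_P(p_u)=0$ for every Fibonacci word $u$ containing at least one letter 2.
   Context: Fibonacci words: finite words in $\{1,2\}$ (including $\varnothing$); rank $|v|$ = sum of digits; $\mathbb{YF}_n$ = words of rank $n$. Head = maximal block of 2's at left end. $v\nearrow w$ iff $w$ arises from $v$ by adding a 1 at the left end, replacing the leftmost 1 by 2, or inserting a 1 between two consecutive 2's of the head or right after the last 2 of the head. $d(u,v)$ = number of chains $u=x_0\nearrow\cdots\nearrow x_r=v$, $d(v)=d(\varnothing,v)$. $R=\mathbb Q\langle X,Y\rangle$ graded by $\deg X=1,\deg Y=2$. Noncommutative determinant $\det(a_{ij})=\sum_\sigma\mathrm{sgn}(\sigma)a_{\sigma(1)1}\cdots a_{\sigma(n)n}$. $P_n$ ($P_0=1$): $n\times n$ tridiagonal determinant with $X$ on diagonal, $Y$ on superdiagonal, $1$ on subdiagonal; $Q_{n-1}$ ($n\ge1$): determinant of the matrix of $P_n$ with first row replaced by $(Y,Y,0,\dots,0)$ and second by $(X,X,Y,0,\dots,0)$ ($Q_0=Y$). For $v=1^{k_t}21^{k_{t-1}}2\cdots1^{k_1}21^{k_0}$: $s_v=P_{k_0}Q_{k_1}\cdots Q_{k_t}$, $p_v=(X^{k_0+2}-(k_0+2)X^{k_0}Y)\cdots(X^{k_{t-1}+2}-(k_{t-1}+2)X^{k_{t-1}}Y)X^{k_t}$. $\{s_v\}_{|v|=n}$ is a basis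 of the degree-$n$ part of $R$. -}

module Defs where

open import Data.Nat as ℕ using (ℕ; zero; suc; _!; _∸_)
open import Data.Nat.Properties using (_!≢0)
open import Data.Integer using (+_)
open import Data.Rational as ℚ using (ℚ; 0ℚ; 1ℚ; _/_)
open import Data.Bool using (Bool; true; false; if_then_else_; _∨_; _∧_)
open import Data.List using (List; []; _∷_; _++_; map; concatMap; foldr; reverse; upTo; length)
open import Data.Nat.ListAction using (sum)
open import Data.Product using (_×_; _,_)
open import Data.Maybe using (Maybe; just; nothing)

-- Fibonacci words (finite words over {1,2}); the leftmost letter is the
-- head of the list.

data Digit : Set where
  one two : Digit

FWord : Set
FWord = List Digit

rank : FWord → ℕ
rank []        = 0
rank (one ∷ w) = suc (rank w)
rank (two ∷ w) = suc (suc (rank w))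

Has2 : FWord → Set
Has2 []        = Data.Bool.T false where import Data.Bool
Has2 (one ∷ w) = Has2 w
Has2 (two ∷ w) = Data.Bool.T true where import Data.Bool

_==d_ : Digit → Digit → Bool
one ==d one = true
two ==d two = true
_   ==d _   = false

_==w_ : FWord → FWord → Bool
[]      ==w []      = true
(a ∷ v) ==w (b ∷ w) = (a ==d b) ∧ (v ==w w)
_       ==w _       = false

replaceLeftmost1 : FWord → Maybe FWord
replaceLeftmost1 []        = nothing
replaceLeftmost1 (one ∷ w) = just (two ∷ w)
replaceLeftmost1 (two ∷ w) with replaceLeftmost1 w
... | just w′ = just (two ∷ w′)
... | nothing = nothing

-- words obtained by inserting a 1 right after the j-th 2 of the head,
-- for j = 1, ..., h (h = length of the head): this is inserting a 1 between
-- two consecutive 2's of the head, or right after the last 2 of the head.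
headInsertions : FWord → List FWord
headInsertions (two ∷ w) = (two ∷ one ∷ w) ∷ map (two ∷_) (headInsertions w)
headInsertions _         = []

succs : FWord → List FWord
succs v = (one ∷ v) ∷ (maybeToList (replaceLeftmost1 v) ++ headInsertions v)
  where
  maybeToList : Maybe FWord → List FWord
  maybeToList (just x) = x ∷ []
  maybeToList nothing  = []

_↗_ : FWord → FWord → Set
v ↗ w = Data.List.Membership.Propositional._∈_ w (succs v)
  where import Data.List.Membership.Propositional

chainsOfLength : ℕ → FWord → FWord → ℕ
chainsOfLength zero    u v = if u ==w v then 1 else 0
chainsOfLength (suc r) u v = sum (map (λ x → chainsOfLength r x v) (succs u))

-- d(u,v): every step of ↗ raises the rank by exactly 1, so every chain from
-- u to v has length rank v ∸ rank u (and there are none if rank v < rank u,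
-- in which case the count below is also 0 since r = 0 forces u = v).
dd : FWord → FWord → ℕ
dd u v = chainsOfLength (rank v ∸ rank u) u v

d : FWord → ℕ
d v = dd [] v

-- R = ℚ⟨X,Y⟩: a polynomial is a formal finite ℚ-linear combination of
-- noncommutative monomials (words in X, Y).

data Var : Set where
  X Y : Var

Monomial : Set
Monomial = List Var

Poly : Set
Poly = List (ℚ × Monomial)

𝟘 : Poly
𝟘 = []

𝟙 : Poly
𝟙 = (1ℚ , []) ∷ []

var : Var → Poly
var x = (1ℚ , x ∷ []) ∷ []

_⊕_ : Poly → Poly → Poly
p ⊕ q = p ++ q

_·_ : ℚ → Poly → Poly
c · p = map (λ { (a , m) → (c ℚ.* a , m) }) p

⊖_ : Poly → Poly
⊖ p = (ℚ.- 1ℚ) · p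

_⊛_ : Poly → Poly → Poly
p ⊛ q = concatMap (λ { (a , m) → map (λ { (b , n) → (a ℚ.* b , m ++ n) }) q }) p

prod : List Poly → Poly
prod = foldr _⊛_ 𝟙

_^^_ : Poly → ℕ → Poly
p ^^ zero  = 𝟙
p ^^ suc n = p ⊛ (p ^^ n)

-- the linear extension to R of a functional given on monomials
LinearFunctional : Set
LinearFunctional = Monomial → ℚ

apply : LinearFunctional → Poly → ℚ
apply φ p = foldr (λ { (a , m) acc → a ℚ.* φ m ℚ.+ acc }) 0ℚ p

-- Noncommutative (column-ordered) determinant
--   det (a_ij) = Σ_σ sgn σ · a_{σ(1)1} ⋯ a_{σ(n)n}
-- Indices are 0-based; a permutation σ of {0,…,n-1} is the list
-- (σ(0), …, σ(n-1)).

insertions : ℕ → List ℕ → List (List ℕ)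
insertions x []       = (x ∷ []) ∷ []
insertions x (y ∷ ys) = (x ∷ y ∷ ys) ∷ map (y ∷_) (insertions x ys)

perms : List ℕ → List (List ℕ)
perms []       = [] ∷ []
perms (x ∷ xs) = concatMap (insertions x) (perms xs)

inversions : List ℕ → ℕ
inversions []       = 0
inversions (x ∷ xs) = length (Data.List.filter (λ y → y ℕ.<? x) xs) ℕ.+ inversions xs
  where import Data.List

sgn : List ℕ → ℚ
sgn σ = parity (inversions σ)
  where
  parity : ℕ → ℚ
  parity zero          = 1ℚ
  parity (suc zero)    = ℚ.- 1ℚ
  parity (suc (suc k)) = parity k

Matrix : Set
Matrix = ℕ → ℕ → Poly   -- entry (row i, column j)

colProduct : Matrix → ℕ → List ℕ → Poly
colProduct A j []       = 𝟙
colProduct A j (i ∷ σ)  = A i j ⊛ colProduct A (suc j) σ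

det : ℕ → Matrix → Poly
det n A = concatMap (λ σ → sgn σ · colProduct A 0 σ) (perms (upTo n))

_≡ᵇ_ : ℕ → ℕ → Bool
_≡ᵇ_ = ℕ._≡ᵇ_

tridiag : Matrix
tridiag i j =
  if i ≡ᵇ j then var X
  else if suc i ≡ᵇ j then var Y
  else if i ≡ᵇ suc j then 𝟙
  else 𝟘

P : ℕ → Poly
P n = det n tridiag

qMatrix : Matrix
qMatrix zero j =
  if (j ≡ᵇ 0) ∨ (j ≡ᵇ 1) then var Y else 𝟘
qMatrix (suc zero) j =
  if (j ≡ᵇ 0) ∨ (j ≡ᵇ 1) then var X
  else if j ≡ᵇ 2 then var Y
  else 𝟘
qMatrix i j = tridiag i j

-- Q k = Q_{(k+1)-1}, the determinant of the modified (k+1)×(k+1) matrix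
-- (for k = 0 this is the 1×1 determinant Y, matching Q_0 = Y)
Q : ℕ → Poly
Q k = det (suc k) qMatrix

-- Decomposition v = 1^{k_t} 2 1^{k_{t-1}} 2 ⋯ 1^{k_1} 2 1^{k_0}

-- blocks read from the left: (k_t, k_{t-1}, …, k_0)
blocksLR : FWord → List ℕ
blocksLR []        = 0 ∷ []
blocksLR (one ∷ w) with blocksLR w
... | []     = 1 ∷ []
... | k ∷ ks = suc k ∷ ks
blocksLR (two ∷ w) = 0 ∷ blocksLR w

-- (k_0, k_1, …, k_t)
blocks : FWord → List ℕ
blocks v = reverse (blocksLR v)

s : FWord → Poly
s v with blocks v
... | []      = 𝟙   -- impossible: blocks is never empty
... | k₀ ∷ ks = P k₀ ⊛ prod (map Q ks)

pFactor : ℕ → Poly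
pFactor k = (var X ^^ suc (suc k)) ⊕ (⊖ ((+ suc (suc k) / 1) · ((var X ^^ k) ⊛ var Y)))

pFrom : List ℕ → Poly
pFrom []           = 𝟙   -- impossible: blocks is never empty
pFrom (k ∷ [])     = var X ^^ k
pFrom (k ∷ l ∷ ks) = pFactor k ⊛ pFrom (l ∷ ks)

p : FWord → Poly
p v = pFrom (blocks v)

dOverFact : FWord → ℚ
dOverFact v = _/_ (+ d v) (rank v !) {{rank v !≢0}}

-- Since the s_v span R, the functional is determined by its values on them, so it suffices
-- to exhibit one functional φP with φP(s_v) = d(v)/|v|! and to check that it kills p_u.
-- Put φP(m) = ∏ 1/(c + 2) over the letters Y of the monomial m, where c is the degree
-- of the part of m before that Y; thus φP(fX) = φP(f) and φP(fY) = φP(f)/(n + 2) for f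
-- homogeneous of degree n. Expanding the determinants along their first column gives
-- P_{n+2} = X P_{n+1} − Y P_n and Q_{k+1} = Y P_{k+1} − XY P_k, whence the right
-- recurrences P_{n+2} = P_{n+1} X − P_n Y, Q_{k+2} = Q_{k+1} X − Q_k Y and YX = Q_1 + XY.
-- These yield s_{2v} = s_v Y and the Pieri rule s_v X = ∑_{v↗w} s_w, so φP(s_v) obeys
-- the same recursion as d(v)/|v|!, namely d(2v) = (|v| + 1) d(v) and
-- d(v)/|v|! = ∑_{v↗w} d(w)/(|v| + 1)!. Finally, if u contains a 2 then p_u has the
-- left factor X^{k+2} − (k + 2) X^k Y, and φP(X^{k+2} h) = (k + 2) φP(X^k Y h) for all h.

module Submission where

open import Defs
open import Data.Rational using (0ℚ)
open import Relation.Binary.PropositionalEquality using (_≡_)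

open import Algebra.Bundles using (CommutativeSemiring; CommutativeRing)
open import Data.Empty using (⊥-elim)
import Data.Integer as ℤ
import Data.Integer.Properties as ℤₚ
open import Data.List
  using (List; []; _∷_; _++_; _∷ʳ_; map; concatMap; foldr; replicate; reverse; upTo; applyUpTo; length)
import Data.List.Properties as Listₚ
open import Data.List.Relation.Binary.Permutation.Propositional using (_↭_; prep; swap; ↭-refl; ↭-trans)
import Data.List.Relation.Binary.Permutation.Propositional.Properties as ↭
open import Data.List.Relation.Unary.All as All using (All; []; _∷_)
import Data.List.Relation.Unary.All.Properties as All
open import Data.Maybe using (just; nothing)
open import Data.Nat as ℕ using (ℕ; zero; suc; _≤_; _<_; _<?_; s≤s; _!; NonZero)
open import Data.Nat.ListAction.Properties using (sum-↭)
import Data.Nat.Properties as ℕₚ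
open import Data.Nat.Tactic.RingSolver using (solve-∀)
open import Data.Product using (_,_; ∃₂; ∃-syntax)
open import Data.Rational as ℚ using (ℚ; 1ℚ; _+_; _*_; -_; _-_)
import Data.Rational.Properties as ℚₚ
open import Algebra.Properties.Group ℚₚ.+-0-group using () renaming (∙-cancelʳ to +-cancelʳ)
open import Data.Rational.Solver using (module +-*-Solver)
open import Data.Rational.Unnormalised as ℚᵘ using (mkℚᵘ; *≡*) renaming (_≃_ to _≃ᵘ_)
import Data.Rational.Unnormalised.Properties as ℚᵘₚ
open import Function using (_∘_)
open import Level using (0ℓ)
open import Relation.Binary.Bundles using (Setoid)
open import Relation.Binary.PropositionalEquality
  using (refl; sym; trans; cong; cong₂; subst; module ≡-Reasoning)
import Relation.Binary.Reasoning.Setoid as SetoidReasoning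
open import Relation.Nullary using (¬_)

module ListSum {c ℓ} (R : CommutativeSemiring c ℓ) where

  private
    module R = CommutativeSemiring R
  open R using (Carrier; 0#; _≈_)
  open SetoidReasoning R.setoid

  ∑ : {A : Set} → List A → (A → Carrier) → Carrier
  ∑ xs f = foldr R._+_ 0# (map f xs)

  module _ {A : Set} where

    ∑-++ : ∀ (xs ys : List A) f → ∑ (xs ++ ys) f ≈ ∑ xs f R.+ ∑ ys f
    ∑-++ []       ys f = R.sym (R.+-identityˡ _)
    ∑-++ (x ∷ xs) ys f = begin
      f x R.+ ∑ (xs ++ ys) f         ≈⟨ R.+-congˡ (∑-++ xs ys f) ⟩
      f x R.+ (∑ xs f R.+ ∑ ys f)    ≈⟨ R.+-assoc _ _ _ ⟨
      f x R.+ ∑ xs f R.+ ∑ ys f      ∎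

    ∑-congᴬ : ∀ {xs : List A} {f g} → All (λ x → f x ≈ g x) xs → ∑ xs f ≈ ∑ xs g
    ∑-congᴬ []       = R.refl
    ∑-congᴬ (e ∷ es) = R.+-cong e (∑-congᴬ es)

    ∑-cong : ∀ (xs : List A) {f g} → (∀ x → f x ≈ g x) → ∑ xs f ≈ ∑ xs g
    ∑-cong []       e = R.refl
    ∑-cong (x ∷ xs) e = R.+-cong (e x) (∑-cong xs e)

    ∑-zero : ∀ (xs : List A) → ∑ xs (λ _ → 0#) ≈ 0#
    ∑-zero []       = R.refl
    ∑-zero (x ∷ xs) = R.trans (R.+-congˡ (∑-zero xs)) (R.+-identityˡ 0#)

    ∑-+ : ∀ (xs : List A) f g → ∑ xs (λ x → f x R.+ g x) ≈ ∑ xs f R.+ ∑ xs g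
    ∑-+ []       f g = R.sym (R.+-identityˡ 0#)
    ∑-+ (x ∷ xs) f g = begin
      f x R.+ g x R.+ ∑ xs (λ x → f x R.+ g x)    ≈⟨ R.+-congˡ (∑-+ xs f g) ⟩
      f x R.+ g x R.+ (∑ xs f R.+ ∑ xs g)         ≈⟨ R.+-assoc _ _ _ ⟩
      f x R.+ (g x R.+ (∑ xs f R.+ ∑ xs g))       ≈⟨ R.+-congˡ (x+[y+z]≈y+[x+z] _ _ _) ⟩
      f x R.+ (∑ xs f R.+ (g x R.+ ∑ xs g))       ≈⟨ R.+-assoc _ _ _ ⟨
      f x R.+ ∑ xs f R.+ (g x R.+ ∑ xs g)         ∎
      where
      x+[y+z]≈y+[x+z] : ∀ a b c → a R.+ (b R.+ c) ≈ b R.+ (a R.+ c)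
      x+[y+z]≈y+[x+z] a b c =
        R.trans (R.sym (R.+-assoc a b c)) (R.trans (R.+-congʳ (R.+-comm a b)) (R.+-assoc b a c))

    ∑-*ˡ : ∀ (xs : List A) a f → ∑ xs (λ x → a R.* f x) ≈ a R.* ∑ xs f
    ∑-*ˡ []       a f = R.sym (R.zeroʳ a)
    ∑-*ˡ (x ∷ xs) a f = R.trans (R.+-congˡ (∑-*ˡ xs a f)) (R.sym (R.distribˡ a _ _))

  ∑-map : ∀ {A B : Set} (g : A → B) xs f → ∑ (map g xs) f ≈ ∑ xs (f ∘ g)
  ∑-map g xs f = R.reflexive (cong (foldr R._+_ 0#) (sym (Listₚ.map-∘ xs)))

  ∑-concatMap : ∀ {A B : Set} (g : A → List B) xs f → ∑ (concatMap g xs) f ≈ ∑ xs (λ x → ∑ (g x) f)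
  ∑-concatMap g []       f = R.refl
  ∑-concatMap g (x ∷ xs) f = R.trans (∑-++ (g x) (concatMap g xs) f) (R.+-congˡ (∑-concatMap g xs f))

  ∑-swap : ∀ {A B : Set} (xs : List A) (ys : List B) (f : A → B → Carrier) →
           ∑ xs (λ x → ∑ ys (f x)) ≈ ∑ ys (λ y → ∑ xs (λ x → f x y))
  ∑-swap []       ys f = R.sym (∑-zero ys)
  ∑-swap (x ∷ xs) ys f =
    R.trans (R.+-congˡ (∑-swap xs ys f)) (R.sym (∑-+ ys (f x) (λ y → ∑ xs (λ x → f x y))))

open ListSum (CommutativeRing.commutativeSemiring ℚₚ.+-*-commutativeRing)
module ℕ∑ = ListSum ℕₚ.+-*-commutativeSemiring

∑-minus : ∀ {A : Set} (xs : List A) f g → ∑ xs (λ x → f x - g x) ≡ ∑ xs f - ∑ xs g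
∑-minus []       f g = refl
∑-minus (x ∷ xs) f g =
  trans (cong (f x - g x +_) (∑-minus xs f g)) (regroup (f x) (g x) (∑ xs f) (∑ xs g))
  where
  open +-*-Solver
  regroup : ∀ a b c d → a - b + (c - d) ≡ a + c - (b + d)
  regroup = solve 4 (λ a b c d → a :- b :+ (c :- d) := a :+ c :- (b :+ d)) refl

module _ (φ : LinearFunctional) where

  apply-++ : ∀ p q → apply φ (p ++ q) ≡ apply φ p + apply φ q
  apply-++ []            q = sym (ℚₚ.+-identityˡ _)
  apply-++ ((a , m) ∷ p) q =
    trans (cong (a * φ m +_) (apply-++ p q)) (sym (ℚₚ.+-assoc (a * φ m) (apply φ p) (apply φ q)))

  apply-· : ∀ c p → apply φ (c · p) ≡ c * apply φ p
  apply-· c []            = sym (ℚₚ.*-zeroʳ c)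
  apply-· c ((a , m) ∷ p) = begin
    c * a * φ m + apply φ (c · p)    ≡⟨ cong₂ _+_ (ℚₚ.*-assoc c a (φ m)) (apply-· c p) ⟩
    c * (a * φ m) + c * apply φ p    ≡⟨ sym (ℚₚ.*-distribˡ-+ c _ _) ⟩
    c * (a * φ m + apply φ p)        ∎
    where open ≡-Reasoning

  apply-⊖ : ∀ p → apply φ (⊖ p) ≡ - apply φ p
  apply-⊖ p = trans (apply-· (- 1ℚ) p)
    (trans (sym (ℚₚ.neg-distribˡ-* 1ℚ (apply φ p))) (cong -_ (ℚₚ.*-identityˡ (apply φ p))))

  apply-concatMap : ∀ {A : Set} (f : A → Poly) xs → apply φ (concatMap f xs) ≡ ∑ xs (apply φ ∘ f)
  apply-concatMap f []       = refl
  apply-concatMap f (x ∷ xs) =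
    trans (apply-++ (f x) (concatMap f xs)) (cong (apply φ (f x) +_) (apply-concatMap f xs))

  apply-𝟙 : apply φ 𝟙 ≡ φ []
  apply-𝟙 = trans (ℚₚ.+-identityʳ _) (ℚₚ.*-identityˡ _)

  apply-var : ∀ x → apply φ (var x) ≡ φ (x ∷ [])
  apply-var x = trans (ℚₚ.+-identityʳ _) (ℚₚ.*-identityˡ _)

apply-cong : ∀ {φ χ : LinearFunctional} → (∀ m → φ m ≡ χ m) → ∀ p → apply φ p ≡ apply χ p
apply-cong e []            = refl
apply-cong e ((a , m) ∷ p) = cong₂ (λ x y → a * x + y) (e m) (apply-cong e p)

apply-+ : ∀ (φ χ : LinearFunctional) p → apply (λ m → φ m + χ m) p ≡ apply φ p + apply χ p
apply-+ φ χ []            = sym (ℚₚ.+-identityʳ 0ℚ)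
apply-+ φ χ ((a , m) ∷ p) = trans (cong (a * (φ m + χ m) +_) (apply-+ φ χ p)) (regroup a (φ m) (χ m) _ _)
  where
  open +-*-Solver
  regroup : ∀ a x y u v → a * (x + y) + (u + v) ≡ (a * x + u) + (a * y + v)
  regroup = solve 5 (λ a x y u v → a :* (x :+ y) :+ (u :+ v) := (a :* x :+ u) :+ (a :* y :+ v)) refl

apply-*ˡ : ∀ (φ : LinearFunctional) c p → apply (λ m → c * φ m) p ≡ c * apply φ p
apply-*ˡ φ c []            = sym (ℚₚ.*-zeroʳ c)
apply-*ˡ φ c ((a , m) ∷ p) = trans (cong (a * (c * φ m) +_) (apply-*ˡ φ c p)) (regroup a c (φ m) _)
  where
  open +-*-Solver
  regroup : ∀ a c x u → a * (c * x) + c * u ≡ c * (a * x + u)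
  regroup = solve 4 (λ a c x u → a :* (c :* x) :+ c :* u := c :* (a :* x :+ u)) refl

apply-0 : ∀ p → apply (λ _ → 0ℚ) p ≡ 0ℚ
apply-0 []            = refl
apply-0 ((a , m) ∷ p) =
  trans (cong (a * 0ℚ +_) (apply-0 p)) (trans (ℚₚ.+-identityʳ _) (ℚₚ.*-zeroʳ a))

_⋊_ : LinearFunctional → Poly → LinearFunctional
(φ ⋊ q) m = apply (λ n → φ (m ++ n)) q

apply-⊛ : ∀ φ p q → apply φ (p ⊛ q) ≡ apply (φ ⋊ q) p
apply-⊛ φ []            q = refl
apply-⊛ φ ((a , m) ∷ p) q = begin
  apply φ (aq ++ p ⊛ q)                   ≡⟨ apply-++ φ aq (p ⊛ q) ⟩
  apply φ aq + apply φ (p ⊛ q)            ≡⟨ cong₂ _+_ (apply-map q) (apply-⊛ φ p q) ⟩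
  a * (φ ⋊ q) m + apply (φ ⋊ q) p         ∎
  where
  open ≡-Reasoning
  aq = map (λ { (b , n) → (a * b , m ++ n) }) q
  apply-map : ∀ q → apply φ (map (λ { (b , n) → (a * b , m ++ n) }) q) ≡ a * (φ ⋊ q) m
  apply-map []            = sym (ℚₚ.*-zeroʳ a)
  apply-map ((b , n) ∷ q) =
    trans (cong₂ _+_ (ℚₚ.*-assoc a b _) (apply-map q)) (sym (ℚₚ.*-distribˡ-+ a _ _))

_◃_ : Var → LinearFunctional → LinearFunctional
(x ◃ φ) m = φ (x ∷ m)

_▹_ : LinearFunctional → Var → LinearFunctional
(φ ▹ x) m = φ (m ++ x ∷ [])

apply-var-⊛ : ∀ φ x q → apply φ (var x ⊛ q) ≡ apply (x ◃ φ) q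
apply-var-⊛ φ x q = trans (apply-⊛ φ (var x) q) (apply-var (φ ⋊ q) x)

apply-⊛-var : ∀ φ p x → apply φ (p ⊛ var x) ≡ apply (φ ▹ x) p
apply-⊛-var φ p x = trans (apply-⊛ φ p (var x)) (apply-cong (λ m → apply-var (λ n → φ (m ++ n)) x) p)

-- A Poly is a list of terms with repetitions; p ≈ q says that they denote the same element of R.
infix 4 _≈_
record _≈_ (p q : Poly) : Set where
  constructor mk≈
  field ≈-apply : ∀ φ → apply φ p ≡ apply φ q
open _≈_ public

≈-setoid : Setoid 0ℓ 0ℓ
≈-setoid = record
  { Carrier       = Poly
  ; _≈_           = _≈_
  ; isEquivalence = record
    { refl  = mk≈ λ φ → refl
    ; sym   = λ e → mk≈ λ φ → sym (≈-apply e φ)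
    ; trans = λ e e′ → mk≈ λ φ → trans (≈-apply e φ) (≈-apply e′ φ)
    }
  }

open Setoid ≈-setoid public
  using () renaming (refl to ≈-refl; sym to ≈-sym; trans to ≈-trans; reflexive to ≡⇒≈)
module ≈-Reasoning = SetoidReasoning ≈-setoid

infixl 6 _⊝_
_⊝_ : Poly → Poly → Poly
p ⊝ q = p ⊕ (⊖ q)

apply-⊝ : ∀ φ p q → apply φ (p ⊝ q) ≡ apply φ p - apply φ q
apply-⊝ φ p q = trans (apply-++ φ p (⊖ q)) (cong (apply φ p +_) (apply-⊖ φ q))

⊕-cong : ∀ {p p′ q q′} → p ≈ p′ → q ≈ q′ → p ⊕ q ≈ p′ ⊕ q′
⊕-cong {p} {p′} {q} {q′} e e′ = mk≈ λ φ → begin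
  apply φ (p ++ q)             ≡⟨ apply-++ φ p q ⟩
  apply φ p + apply φ q        ≡⟨ cong₂ _+_ (≈-apply e φ) (≈-apply e′ φ) ⟩
  apply φ p′ + apply φ q′      ≡⟨ apply-++ φ p′ q′ ⟨
  apply φ (p′ ++ q′)           ∎
  where open ≡-Reasoning

⊖-cong : ∀ {p p′} → p ≈ p′ → ⊖ p ≈ ⊖ p′
⊖-cong {p} {p′} e = mk≈ λ φ →
  trans (apply-⊖ φ p) (trans (cong -_ (≈-apply e φ)) (sym (apply-⊖ φ p′)))

⊝-cong : ∀ {p p′ q q′} → p ≈ p′ → q ≈ q′ → p ⊝ q ≈ p′ ⊝ q′
⊝-cong e e′ = ⊕-cong e (⊖-cong e′)

⊛-congˡ : ∀ {p p′} q → p ≈ p′ → p ⊛ q ≈ p′ ⊛ q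
⊛-congˡ {p} {p′} q e = mk≈ λ φ →
  trans (apply-⊛ φ p q) (trans (≈-apply e (φ ⋊ q)) (sym (apply-⊛ φ p′ q)))

⊛-congʳ : ∀ p {q q′} → q ≈ q′ → p ⊛ q ≈ p ⊛ q′
⊛-congʳ p {q} {q′} e = mk≈ λ φ →
  trans (apply-⊛ φ p q)
        (trans (apply-cong (λ m → ≈-apply e (λ n → φ (m ++ n))) p) (sym (apply-⊛ φ p q′)))

⊛-cong : ∀ {p p′ q q′} → p ≈ p′ → q ≈ q′ → p ⊛ q ≈ p′ ⊛ q′
⊛-cong {p′ = p′} {q} e e′ = ≈-trans (⊛-congˡ q e) (⊛-congʳ p′ e′)

⊛-assoc : ∀ p q r → (p ⊛ q) ⊛ r ≈ p ⊛ (q ⊛ r)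
⊛-assoc p q r = mk≈ λ φ → begin
  apply φ ((p ⊛ q) ⊛ r)          ≡⟨ apply-⊛ φ (p ⊛ q) r ⟩
  apply (φ ⋊ r) (p ⊛ q)          ≡⟨ apply-⊛ (φ ⋊ r) p q ⟩
  apply ((φ ⋊ r) ⋊ q) p          ≡⟨ apply-cong (λ m → sym (⋊-⊛ φ m)) p ⟩
  apply (φ ⋊ (q ⊛ r)) p          ≡⟨ apply-⊛ φ p (q ⊛ r) ⟨
  apply φ (p ⊛ (q ⊛ r))          ∎
  where
  open ≡-Reasoning
  ⋊-⊛ : ∀ φ m → (φ ⋊ (q ⊛ r)) m ≡ ((φ ⋊ r) ⋊ q) m
  ⋊-⊛ φ m = trans (apply-⊛ _ q r)
    (apply-cong (λ n → apply-cong (λ k → cong φ (sym (Listₚ.++-assoc m n k))) r) q)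

⊛-identityˡ : ∀ p → 𝟙 ⊛ p ≈ p
⊛-identityˡ p = mk≈ λ φ → trans (apply-⊛ φ 𝟙 p) (apply-𝟙 (φ ⋊ p))

⊛-identityʳ : ∀ p → p ⊛ 𝟙 ≈ p
⊛-identityʳ p = mk≈ λ φ → trans (apply-⊛ φ p 𝟙)
  (apply-cong (λ m → trans (apply-𝟙 (λ n → φ (m ++ n))) (cong φ (Listₚ.++-identityʳ m))) p)

⊛-zeroʳ : ∀ p → p ⊛ 𝟘 ≈ 𝟘
⊛-zeroʳ p = mk≈ λ φ → trans (apply-⊛ φ p 𝟘) (apply-0 p)

⊛-distribˡ : ∀ p q r → p ⊛ (q ⊕ r) ≈ (p ⊛ q) ⊕ (p ⊛ r)
⊛-distribˡ p q r = mk≈ λ φ → begin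
  apply φ (p ⊛ (q ⊕ r))                          ≡⟨ apply-⊛ φ p (q ⊕ r) ⟩
  apply (φ ⋊ (q ⊕ r)) p                          ≡⟨ apply-cong (λ m → apply-++ _ q r) p ⟩
  apply (λ m → (φ ⋊ q) m + (φ ⋊ r) m) p          ≡⟨ apply-+ (φ ⋊ q) (φ ⋊ r) p ⟩
  apply (φ ⋊ q) p + apply (φ ⋊ r) p              ≡⟨ cong₂ _+_ (apply-⊛ φ p q) (apply-⊛ φ p r) ⟨
  apply φ (p ⊛ q) + apply φ (p ⊛ r)              ≡⟨ apply-++ φ (p ⊛ q) (p ⊛ r) ⟨
  apply φ ((p ⊛ q) ⊕ (p ⊛ r))                    ∎
  where open ≡-Reasoning

⊛-distribʳ : ∀ p q r → (p ⊕ q) ⊛ r ≡ (p ⊛ r) ⊕ (q ⊛ r)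
⊛-distribʳ p q r = Listₚ.concatMap-++ _ p q

⊛-·ʳ : ∀ p a q → p ⊛ (a · q) ≈ a · (p ⊛ q)
⊛-·ʳ p a q = mk≈ λ φ → begin
  apply φ (p ⊛ (a · q))             ≡⟨ apply-⊛ φ p (a · q) ⟩
  apply (φ ⋊ (a · q)) p             ≡⟨ apply-cong (λ m → apply-· _ a q) p ⟩
  apply (λ m → a * (φ ⋊ q) m) p     ≡⟨ apply-*ˡ (φ ⋊ q) a p ⟩
  a * apply (φ ⋊ q) p               ≡⟨ cong (a *_) (apply-⊛ φ p q) ⟨
  a * apply φ (p ⊛ q)               ≡⟨ apply-· φ a (p ⊛ q) ⟨
  apply φ (a · (p ⊛ q))             ∎
  where open ≡-Reasoning

⊛-vanishesʳ : ∀ p {q} → q ≈ 𝟘 → p ⊛ q ≈ 𝟘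
⊛-vanishesʳ p e = ≈-trans (⊛-congʳ p e) (⊛-zeroʳ p)

⊛-concatMap : ∀ {B : Set} p (a : B → ℚ) (C : B → Poly) l →
  p ⊛ concatMap (λ σ → a σ · C σ) l ≈ concatMap (λ σ → a σ · (p ⊛ C σ)) l
⊛-concatMap p a C []      = ⊛-zeroʳ p
⊛-concatMap p a C (σ ∷ l) =
  ≈-trans (⊛-distribˡ p (a σ · C σ) _) (⊕-cong (⊛-·ʳ p (a σ) (C σ)) (⊛-concatMap p a C l))

-- Column-ordered determinants

sign : ℕ → ℚ
sign zero          = 1ℚ
sign (suc zero)    = - 1ℚ
sign (suc (suc k)) = sign k

sign-suc : ∀ k → sign (suc k) ≡ - sign k
sign-suc zero          = refl
sign-suc (suc zero)    = refl
sign-suc (suc (suc k)) = sign-suc k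

-- sgn applies a sign function local to its definition to the number of inversions;
-- unification recovers that function as parity.
mutual
  private
    parity : List ℕ → ℕ → ℚ
    parity = _

    sgn≡parity : ∀ σ → sgn σ ≡ parity σ (inversions σ)
    sgn≡parity σ with inversions σ
    ... | _ = refl

  parity≡sign : ∀ σ k → parity σ k ≡ sign k
  parity≡sign σ zero          = refl
  parity≡sign σ (suc zero)    = refl
  parity≡sign σ (suc (suc k)) = parity≡sign σ k

sgn≡sign : ∀ σ → sgn σ ≡ sign (inversions σ)
sgn≡sign σ = trans (sgn≡parity σ) (parity≡sign σ (inversions σ))

module _ {x : ℕ} where

  inversions-min : ∀ {π} → All (x <_) π → inversions (x ∷ π) ≡ inversions π
  inversions-min {π} x<π = cong (λ l → length l ℕ.+ inversions π)
    (Listₚ.filter-none (_<? x) (All.map (λ x<y y<x → ℕₚ.<-asym x<y y<x) x<π))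

  inversions-swap : ∀ {y τ} → x < y → All (x <_) τ →
                    inversions (y ∷ x ∷ τ) ≡ suc (inversions (y ∷ τ))
  inversions-swap {y} {τ} x<y x<τ = cong₂ (λ l l′ → length l ℕ.+ (length l′ ℕ.+ inversions τ))
    (Listₚ.filter-accept (_<? y) x<y)
    (Listₚ.filter-none (_<? x) (All.map (λ x<z z<x → ℕₚ.<-asym x<z z<x) x<τ))

  sgn-min : ∀ {π} → All (x <_) π → sgn (x ∷ π) ≡ sgn π
  sgn-min {π} x<π =
    trans (sgn≡sign (x ∷ π)) (trans (cong sign (inversions-min x<π)) (sym (sgn≡sign π)))

  sgn-swap : ∀ {y τ} → x < y → All (x <_) τ → sgn (y ∷ x ∷ τ) ≡ - sgn (y ∷ τ)
  sgn-swap {y} {τ} x<y x<τ = begin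
    sgn (y ∷ x ∷ τ)                 ≡⟨ sgn≡sign (y ∷ x ∷ τ) ⟩
    sign (inversions (y ∷ x ∷ τ))   ≡⟨ cong sign (inversions-swap x<y x<τ) ⟩
    sign (suc (inversions (y ∷ τ))) ≡⟨ sign-suc (inversions (y ∷ τ)) ⟩
    - sign (inversions (y ∷ τ))     ≡⟨ cong -_ (sgn≡sign (y ∷ τ)) ⟨
    - sgn (y ∷ τ)                   ∎
    where open ≡-Reasoning

rowsFrom : ℕ → ℕ → List ℕ
rowsFrom c zero    = []
rowsFrom c (suc m) = c ∷ rowsFrom (suc c) m

rowsFrom-≥ : ∀ c m → All (c ≤_) (rowsFrom c m)
rowsFrom-≥ c zero    = []
rowsFrom-≥ c (suc m) = ℕₚ.≤-refl ∷ All.map (ℕₚ.≤-trans (ℕₚ.n≤1+n c)) (rowsFrom-≥ (suc c) m)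

upTo≡rowsFrom : ∀ n → upTo n ≡ rowsFrom 0 n
upTo≡rowsFrom n = applyUpTo-shift (λ i → i) n λ i → sym (ℕₚ.+-identityʳ i)
  where
  applyUpTo-shift : ∀ {c} f n → (∀ i → f i ≡ i ℕ.+ c) → applyUpTo f n ≡ rowsFrom c n
  applyUpTo-shift f zero    e = refl
  applyUpTo-shift {c} f (suc n) e =
    cong₂ _∷_ (e 0) (applyUpTo-shift (f ∘ suc) n λ i → trans (e (suc i)) (sym (ℕₚ.+-suc i c)))

detBlock : Matrix → ℕ → ℕ → Poly
detBlock A c m = concatMap (λ σ → sgn σ · colProduct A c σ) (perms (rowsFrom c m))

det≡detBlock : ∀ n A → det n A ≡ detBlock A 0 n
det≡detBlock n A =
  cong (λ rows → concatMap (λ σ → sgn σ · colProduct A 0 σ) (perms rows)) (upTo≡rowsFrom n)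

apply-⊛-detBlock : ∀ φ p A c m → apply φ (p ⊛ detBlock A c m)
                   ≡ ∑ (perms (rowsFrom c m)) (λ σ → sgn σ * apply φ (p ⊛ colProduct A c σ))
apply-⊛-detBlock φ p A c m = begin
  apply φ (p ⊛ detBlock A c m)
    ≡⟨ ≈-apply (⊛-concatMap p sgn (colProduct A c) (perms (rowsFrom c m))) φ ⟩
  apply φ (concatMap (λ σ → sgn σ · (p ⊛ colProduct A c σ)) (perms (rowsFrom c m)))
    ≡⟨ apply-concatMap φ _ (perms (rowsFrom c m)) ⟩
  ∑ (perms (rowsFrom c m)) (λ σ → apply φ (sgn σ · (p ⊛ colProduct A c σ)))
    ≡⟨ ∑-cong (perms (rowsFrom c m)) (λ σ → apply-· φ (sgn σ) (p ⊛ colProduct A c σ)) ⟩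
  ∑ (perms (rowsFrom c m)) (λ σ → sgn σ * apply φ (p ⊛ colProduct A c σ)) ∎
  where open ≡-Reasoning

laterInsertions : ℕ → List ℕ → List (List ℕ)
laterInsertions x []       = []
laterInsertions x (y ∷ ys) = map (y ∷_) (insertions x ys)

insertions-head : ∀ x τ → insertions x τ ≡ (x ∷ τ) ∷ laterInsertions x τ
insertions-head x []      = refl
insertions-head x (y ∷ τ) = refl

module _ {P : ℕ → Set} where

  insertions-All : ∀ {x} τ → P x → All P τ → All (All P) (insertions x τ)
  insertions-All []      px []         = (px ∷ []) ∷ []
  insertions-All (y ∷ τ) px (py ∷ pτ) =
    (px ∷ py ∷ pτ) ∷ All.map⁺ (All.map (py ∷_) (insertions-All τ px pτ))

  perms-All : ∀ {L} → All P L → All (All P) (perms L)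
  perms-All []         = [] ∷ []
  perms-All (px ∷ pL) =
    All.concat⁺ (All.map⁺ (All.map (λ {π} → insertions-All π px) (perms-All pL)))

mutual
  insertions-vanish : ∀ A {x j} → (∀ r → j ≤ r → A x r ≡ 𝟘) →
    ∀ τ → All (λ σ → colProduct A j σ ≈ 𝟘) (insertions x τ)
  insertions-vanish A {x} {j} row-x τ = subst (All _) (sym (insertions-head x τ))
    (⊛-congˡ _ (≡⇒≈ (row-x j ℕₚ.≤-refl)) ∷ laterInsertions-vanish A row-x′ τ)
    where
    row-x′ : ∀ r → suc j ≤ r → A x r ≡ 𝟘
    row-x′ r j<r = row-x r (ℕₚ.<⇒≤ j<r)

  laterInsertions-vanish : ∀ A {x j} → (∀ r → suc j ≤ r → A x r ≡ 𝟘) →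
    ∀ τ → All (λ σ → colProduct A j σ ≈ 𝟘) (laterInsertions x τ)
  laterInsertions-vanish A row-x []      = []
  laterInsertions-vanish A {j = j} row-x (y ∷ τ) =
    All.map⁺ (All.map (⊛-vanishesʳ (A y j)) (insertions-vanish A row-x τ))

private
  module Expansion (A : Matrix) (c : ℕ)
    (row-c : ∀ r → 2 ℕ.+ c ≤ r → A c r ≡ 𝟘) (col-c : ∀ r → 2 ℕ.+ c ≤ r → A r c ≡ 𝟘)
    (φ : LinearFunctional) where

    open ≡-Reasoning

    corner : Poly
    corner = A (suc c) c ⊛ A c (suc c)

    term : List ℕ → ℚ
    term σ = sgn σ * apply φ (colProduct A c σ)

    first : List ℕ → ℚ
    first π = sgn π * apply φ (A c c ⊛ colProduct A (suc c) π)

    second : List ℕ → ℚ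
    second []      = 0ℚ
    second (y ∷ τ) = sgn (y ∷ τ) * apply φ ((A y c ⊛ A c (suc c)) ⊛ colProduct A (2 ℕ.+ c) τ)

    apply-detBlock : ∀ n → apply φ (detBlock A c n) ≡ ∑ (perms (rowsFrom c n)) term
    apply-detBlock n = trans (apply-concatMap φ _ (perms (rowsFrom c n)))
      (∑-cong (perms (rowsFrom c n)) (λ σ → apply-· φ (sgn σ) (colProduct A c σ)))

    -- Row c vanishes beyond column c + 1, so only its first two insertion positions contribute.
    insert-c : ∀ π → All (c <_) π → ∑ (insertions c π) term ≡ first π - second π
    insert-c []      []            = refl
    insert-c (y ∷ τ) (c<y ∷ c<τ) = begin
      ∑ (insertions c (y ∷ τ)) term
        ≡⟨ cong (λ l → term (c ∷ y ∷ τ) + ∑ (map (y ∷_) l) term) (insertions-head c τ) ⟩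
      term (c ∷ y ∷ τ) + (term (y ∷ c ∷ τ) + ∑ (map (y ∷_) (laterInsertions c τ)) term)
        ≡⟨ cong₂ (λ a b → a + (b + ∑ (map (y ∷_) (laterInsertions c τ)) term)) c-first c-second ⟩
      first (y ∷ τ) + (- second (y ∷ τ) + ∑ (map (y ∷_) (laterInsertions c τ)) term)
        ≡⟨ cong (λ b → first (y ∷ τ) + (- second (y ∷ τ) + b)) c-later ⟩
      first (y ∷ τ) + (- second (y ∷ τ) + 0ℚ)
        ≡⟨ cong (first (y ∷ τ) +_) (ℚₚ.+-identityʳ _) ⟩
      first (y ∷ τ) - second (y ∷ τ) ∎
      where
      W = apply φ ((A y c ⊛ A c (suc c)) ⊛ colProduct A (2 ℕ.+ c) τ)
      c-first : term (c ∷ y ∷ τ) ≡ first (y ∷ τ)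
      c-first = cong (_* apply φ (colProduct A c (c ∷ y ∷ τ))) (sgn-min (c<y ∷ c<τ))
      c-second : term (y ∷ c ∷ τ) ≡ - second (y ∷ τ)
      c-second = begin
        sgn (y ∷ c ∷ τ) * apply φ (A y c ⊛ (A c (suc c) ⊛ colProduct A (2 ℕ.+ c) τ))
          ≡⟨ cong₂ _*_ (sgn-swap c<y c<τ) (sym (≈-apply (⊛-assoc (A y c) (A c (suc c)) _) φ)) ⟩
        - sgn (y ∷ τ) * W
          ≡⟨ ℚₚ.neg-distribˡ-* (sgn (y ∷ τ)) W ⟨
        - second (y ∷ τ) ∎
      c-later : ∑ (map (y ∷_) (laterInsertions c τ)) term ≡ 0ℚ
      c-later = begin
        ∑ (map (y ∷_) (laterInsertions c τ)) term
          ≡⟨ ∑-map (y ∷_) (laterInsertions c τ) term ⟩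
        ∑ (laterInsertions c τ) (term ∘ (y ∷_))
          ≡⟨ ∑-congᴬ (All.map (λ {σ} → vanishing σ) (laterInsertions-vanish A row-c τ)) ⟩
        ∑ (laterInsertions c τ) (λ _ → 0ℚ)
          ≡⟨ ∑-zero (laterInsertions c τ) ⟩
        0ℚ ∎
        where
        vanishing : ∀ σ → colProduct A (suc c) σ ≈ 𝟘 → term (y ∷ σ) ≡ 0ℚ
        vanishing σ e = trans (cong (sgn (y ∷ σ) *_) (≈-apply (⊛-vanishesʳ (A y c) e) φ))
                              (ℚₚ.*-zeroʳ (sgn (y ∷ σ)))

    second-vanishes : ∀ z σ → A z c ≡ 𝟘 → second (z ∷ σ) ≡ 0ℚ
    second-vanishes z σ e rewrite e = ℚₚ.*-zeroʳ (sgn (z ∷ σ))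

    -- Column c vanishes below row c + 1, so only placing row c + 1 first contributes.
    insert-suc-c : ∀ τ → All (suc c <_) τ →
      ∑ (insertions (suc c) τ) second ≡ sgn τ * apply φ (corner ⊛ colProduct A (2 ℕ.+ c) τ)
    insert-suc-c []      []            = ℚₚ.+-identityʳ _
    insert-suc-c (z ∷ τ) (c<z ∷ c<τ) = begin
      second (suc c ∷ z ∷ τ) + ∑ (map (z ∷_) (insertions (suc c) τ)) second
        ≡⟨ cong₂ _+_ (cong (_* apply φ (corner ⊛ colProduct A (2 ℕ.+ c) (z ∷ τ))) (sgn-min (c<z ∷ c<τ)))
                     later ⟩
      sgn (z ∷ τ) * apply φ (corner ⊛ colProduct A (2 ℕ.+ c) (z ∷ τ)) + 0ℚ
        ≡⟨ ℚₚ.+-identityʳ _ ⟩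
      sgn (z ∷ τ) * apply φ (corner ⊛ colProduct A (2 ℕ.+ c) (z ∷ τ)) ∎
      where
      later : ∑ (map (z ∷_) (insertions (suc c) τ)) second ≡ 0ℚ
      later = trans (∑-map (z ∷_) (insertions (suc c) τ) second)
        (trans (∑-cong (insertions (suc c) τ) (λ σ → second-vanishes z σ (col-c z c<z)))
               (∑-zero (insertions (suc c) τ)))

    expand : ∀ m → apply φ (detBlock A c (2 ℕ.+ m))
      ≡ apply φ (A c c ⊛ detBlock A (suc c) (suc m)) - apply φ (corner ⊛ detBlock A (2 ℕ.+ c) m)
    expand m = begin
      apply φ (detBlock A c (2 ℕ.+ m))
        ≡⟨ apply-detBlock (2 ℕ.+ m) ⟩
      ∑ (concatMap (insertions c) (perms rows₁)) term
        ≡⟨ ∑-concatMap (insertions c) (perms rows₁) term ⟩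
      ∑ (perms rows₁) (λ π → ∑ (insertions c π) term)
        ≡⟨ ∑-congᴬ (All.map (λ {π} → insert-c π) (perms-All (rowsFrom-≥ (suc c) (suc m)))) ⟩
      ∑ (perms rows₁) (λ π → first π - second π)
        ≡⟨ ∑-minus (perms rows₁) first second ⟩
      ∑ (perms rows₁) first - ∑ (perms rows₁) second
        ≡⟨ cong₂ _-_ (sym (apply-⊛-detBlock φ (A c c) A (suc c) (suc m))) second-total ⟩
      apply φ (A c c ⊛ detBlock A (suc c) (suc m)) - apply φ (corner ⊛ detBlock A (2 ℕ.+ c) m) ∎
      where
      rows₁ = rowsFrom (suc c) (suc m)
      rows₂ = rowsFrom (2 ℕ.+ c) m
      second-total : ∑ (perms rows₁) second ≡ apply φ (corner ⊛ detBlock A (2 ℕ.+ c) m)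
      second-total = begin
        ∑ (concatMap (insertions (suc c)) (perms rows₂)) second
          ≡⟨ ∑-concatMap (insertions (suc c)) (perms rows₂) second ⟩
        ∑ (perms rows₂) (λ τ → ∑ (insertions (suc c) τ) second)
          ≡⟨ ∑-congᴬ (All.map (λ {τ} → insert-suc-c τ) (perms-All (rowsFrom-≥ (2 ℕ.+ c) m))) ⟩
        ∑ (perms rows₂) (λ τ → sgn τ * apply φ (corner ⊛ colProduct A (2 ℕ.+ c) τ))
          ≡⟨ apply-⊛-detBlock φ corner A (2 ℕ.+ c) m ⟨
        apply φ (corner ⊛ detBlock A (2 ℕ.+ c) m) ∎

detBlock-expand : ∀ A c m →
  (∀ r → 2 ℕ.+ c ≤ r → A c r ≡ 𝟘) → (∀ r → 2 ℕ.+ c ≤ r → A r c ≡ 𝟘) →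
  detBlock A c (2 ℕ.+ m) ≈
    (A c c ⊛ detBlock A (suc c) (suc m)) ⊝ ((A (suc c) c ⊛ A c (suc c)) ⊛ detBlock A (2 ℕ.+ c) m)
detBlock-expand A c m row-c col-c = mk≈ λ φ →
  trans (Expansion.expand A c row-c col-c φ m)
        (sym (apply-⊝ φ (A c c ⊛ detBlock A (suc c) (suc m))
                        ((A (suc c) c ⊛ A c (suc c)) ⊛ detBlock A (2 ℕ.+ c) m)))

detBlock-1 : ∀ A c → detBlock A c 1 ≈ A c c
detBlock-1 A c = mk≈ λ φ → begin
  apply φ ((1ℚ · (A c c ⊛ 𝟙)) ++ [])
                                      ≡⟨ cong (apply φ) (Listₚ.++-identityʳ (1ℚ · (A c c ⊛ 𝟙))) ⟩
  apply φ (1ℚ · (A c c ⊛ 𝟙))          ≡⟨ apply-· φ 1ℚ (A c c ⊛ 𝟙) ⟩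
  1ℚ * apply φ (A c c ⊛ 𝟙)            ≡⟨ ℚₚ.*-identityˡ _ ⟩
  apply φ (A c c ⊛ 𝟙)                 ≡⟨ ≈-apply (⊛-identityʳ (A c c)) φ ⟩
  apply φ (A c c)                     ∎
  where open ≡-Reasoning

P′ : ℕ → Poly
P′ zero          = 𝟙
P′ (suc zero)    = var X
P′ (suc (suc n)) = (var X ⊛ P′ (suc n)) ⊝ (var Y ⊛ P′ n)

Q′ : ℕ → Poly
Q′ zero    = var Y
Q′ (suc k) = (var Y ⊛ P′ (suc k)) ⊝ (var X ⊛ (var Y ⊛ P′ k))

tridiag-diag : ∀ i → tridiag i i ≡ var X
tridiag-diag zero    = refl
tridiag-diag (suc i) = tridiag-diag i

tridiag-sub : ∀ i → tridiag (suc i) i ≡ 𝟙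
tridiag-sub zero    = refl
tridiag-sub (suc i) = tridiag-sub i

tridiag-super : ∀ i → tridiag i (suc i) ≡ var Y
tridiag-super zero    = refl
tridiag-super (suc i) = tridiag-super i

tridiag-right : ∀ i j → 2 ℕ.+ i ≤ j → tridiag i j ≡ 𝟘
tridiag-right zero    (suc zero)    (s≤s ())
tridiag-right zero    (suc (suc j)) _         = refl
tridiag-right (suc i) (suc j)       (s≤s i<j) = tridiag-right i j i<j

tridiag-below : ∀ i j → 2 ℕ.+ j ≤ i → tridiag i j ≡ 𝟘
tridiag-below (suc zero)    zero    (s≤s ())
tridiag-below (suc (suc i)) zero    _         = refl
tridiag-below (suc i)       (suc j) (s≤s j<i) = tridiag-below i j j<i

TridiagonalFrom : ℕ → Matrix → Set
TridiagonalFrom c A = ∀ i j → c ≤ i → c ≤ j → A i j ≡ tridiag i j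

detBlock≈P′ : ∀ A c m → TridiagonalFrom c A → detBlock A c m ≈ P′ m
detBlock≈P′ A c zero          tri = ≈-refl
detBlock≈P′ A c (suc zero)    tri =
  ≈-trans (detBlock-1 A c) (≡⇒≈ (trans (tri c c ℕₚ.≤-refl ℕₚ.≤-refl) (tridiag-diag c)))
detBlock≈P′ A c (suc (suc m)) tri = begin
  detBlock A c (2 ℕ.+ m)
    ≈⟨ detBlock-expand A c m row-c col-c ⟩
  (A c c ⊛ detBlock A (suc c) (suc m)) ⊝ ((A (suc c) c ⊛ A c (suc c)) ⊛ detBlock A (2 ℕ.+ c) m)
    ≈⟨ ⊝-cong (⊛-cong (≡⇒≈ (entry c c ≤-refl ≤-refl (tridiag-diag c)))
                      (detBlock≈P′ A (suc c) (suc m) (shift tri)))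
              (⊛-cong (⊛-cong (≡⇒≈ (entry (suc c) c c≤1+c ≤-refl (tridiag-sub c)))
                              (≡⇒≈ (entry c (suc c) ≤-refl c≤1+c (tridiag-super c))))
                      (detBlock≈P′ A (2 ℕ.+ c) m (shift (shift tri)))) ⟩
  (var X ⊛ P′ (suc m)) ⊝ ((𝟙 ⊛ var Y) ⊛ P′ m)
    ≈⟨ ⊝-cong ≈-refl (⊛-congˡ (P′ m) (⊛-identityˡ (var Y))) ⟩
  P′ (2 ℕ.+ m) ∎
  where
  open ≈-Reasoning
  ≤-refl = ℕₚ.≤-refl
  c≤1+c = ℕₚ.n≤1+n c
  entry : ∀ i j → c ≤ i → c ≤ j → ∀ {e} → tridiag i j ≡ e → A i j ≡ e
  entry i j c≤i c≤j t = trans (tri i j c≤i c≤j) t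
  shift : ∀ {d} → TridiagonalFrom d A → TridiagonalFrom (suc d) A
  shift t i j d<i d<j = t i j (ℕₚ.<⇒≤ d<i) (ℕₚ.<⇒≤ d<j)
  row-c : ∀ r → 2 ℕ.+ c ≤ r → A c r ≡ 𝟘
  row-c r c+2≤r = entry c r ≤-refl (ℕₚ.≤-trans c≤1+c (ℕₚ.<⇒≤ c+2≤r)) (tridiag-right c r c+2≤r)
  col-c : ∀ r → 2 ℕ.+ c ≤ r → A r c ≡ 𝟘
  col-c r c+2≤r = entry r c (ℕₚ.≤-trans c≤1+c (ℕₚ.<⇒≤ c+2≤r)) ≤-refl (tridiag-below r c c+2≤r)

P≈P′ : ∀ n → P n ≈ P′ n
P≈P′ n = ≈-trans (≡⇒≈ (det≡detBlock n tridiag)) (detBlock≈P′ tridiag 0 n λ i j _ _ → refl)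

qMatrix-tridiagonal : TridiagonalFrom 1 qMatrix
qMatrix-tridiagonal (suc zero)    (suc zero)          _ _ = refl
qMatrix-tridiagonal (suc zero)    (suc (suc zero))    _ _ = refl
qMatrix-tridiagonal (suc zero)    (suc (suc (suc j))) _ _ = refl
qMatrix-tridiagonal (suc (suc i)) (suc j)             _ _ = refl

Q≈Q′ : ∀ k → Q k ≈ Q′ k
Q≈Q′ zero    = detBlock-1 qMatrix 0
Q≈Q′ (suc k) = begin
  Q (suc k)
    ≡⟨ det≡detBlock (2 ℕ.+ k) qMatrix ⟩
  detBlock qMatrix 0 (2 ℕ.+ k)
    ≈⟨ detBlock-expand qMatrix 0 k row-0 col-0 ⟩
  (var Y ⊛ detBlock qMatrix 1 (suc k)) ⊝ ((var X ⊛ var Y) ⊛ detBlock qMatrix 2 k)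
    ≈⟨ ⊝-cong (⊛-congʳ (var Y) (detBlock≈P′ qMatrix 1 (suc k) qMatrix-tridiagonal))
              (≈-trans (⊛-assoc (var X) (var Y) _)
                       (⊛-congʳ (var X) (⊛-congʳ (var Y) (detBlock≈P′ qMatrix 2 k tail)))) ⟩
  Q′ (suc k) ∎
  where
  open ≈-Reasoning
  tail : TridiagonalFrom 2 qMatrix
  tail i j 1<i 1<j = qMatrix-tridiagonal i j (ℕₚ.<⇒≤ 1<i) (ℕₚ.<⇒≤ 1<j)
  row-0 : ∀ r → 2 ≤ r → qMatrix 0 r ≡ 𝟘
  row-0 (suc zero)    (s≤s ())
  row-0 (suc (suc r)) _ = refl
  col-0 : ∀ r → 2 ≤ r → qMatrix r 0 ≡ 𝟘
  col-0 (suc zero)    (s≤s ())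
  col-0 (suc (suc r)) _ = refl

P′-left : ∀ φ n → apply φ (P′ (2 ℕ.+ n)) ≡ apply (X ◃ φ) (P′ (suc n)) - apply (Y ◃ φ) (P′ n)
P′-left φ n = trans (apply-⊝ φ (var X ⊛ P′ (suc n)) (var Y ⊛ P′ n))
  (cong₂ _-_ (apply-var-⊛ φ X (P′ (suc n))) (apply-var-⊛ φ Y (P′ n)))

Q′-left : ∀ φ k → apply φ (Q′ (suc k)) ≡ apply (Y ◃ φ) (P′ (suc k)) - apply (Y ◃ (X ◃ φ)) (P′ k)
Q′-left φ k = trans (apply-⊝ φ (var Y ⊛ P′ (suc k)) (var X ⊛ (var Y ⊛ P′ k)))
  (cong₂ _-_ (apply-var-⊛ φ Y (P′ (suc k)))
             (trans (apply-var-⊛ φ X (var Y ⊛ P′ k)) (apply-var-⊛ (X ◃ φ) Y (P′ k))))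

private
  a-b-c≡a-c-b : ∀ a b c → a - b - c ≡ a - c - b
  a-b-c≡a-c-b = solve 3 (λ a b c → a :- b :- c := a :- c :- b) refl
    where open +-*-Solver

  a-b-[c-d]≡a-c-[b-d] : ∀ a b c d → a - b - (c - d) ≡ a - c - (b - d)
  a-b-[c-d]≡a-c-[b-d] = solve 4 (λ a b c d → a :- b :- (c :- d) := a :- c :- (b :- d)) refl
    where open +-*-Solver

  a≡a-b+b : ∀ a b → a ≡ a - b + b
  a≡a-b+b = solve 2 (λ a b → a := a :- b :+ b) refl
    where open +-*-Solver

-- Left and right translations commute definitionally, so the right recurrence
-- follows from the left one by induction, simultaneously for all functionals.
P′-right : ∀ n φ → apply φ (P′ (2 ℕ.+ n)) ≡ apply (φ ▹ X) (P′ (suc n)) - apply (φ ▹ Y) (P′ n)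
P′-right zero          φ = P′-left φ 0
P′-right (suc zero)    φ = begin
  apply φ (P′ 3)                                 ≡⟨ P′-left φ 1 ⟩
  apply (X ◃ φ) (P′ 2) - t₃                      ≡⟨ cong (_- t₃) (P′-left (X ◃ φ) 0) ⟩
  t₁ - t₂ - t₃                                   ≡⟨ a-b-c≡a-c-b t₁ t₂ t₃ ⟩
  t₁ - t₃ - t₂                                   ≡⟨ cong (_- t₂) (P′-left (φ ▹ X) 0) ⟨
  apply (φ ▹ X) (P′ 2) - apply (φ ▹ Y) (P′ 1)    ∎
  where
  open ≡-Reasoning
  t₁ = apply (X ◃ (φ ▹ X)) (P′ 1)
  t₂ = apply (φ ▹ Y) (P′ 1)
  t₃ = apply (Y ◃ φ) (P′ 1)
P′-right (suc (suc n)) φ = begin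
  apply φ (P′ (4 ℕ.+ n))
    ≡⟨ P′-left φ (2 ℕ.+ n) ⟩
  apply (X ◃ φ) (P′ (3 ℕ.+ n)) - apply (Y ◃ φ) (P′ (2 ℕ.+ n))
    ≡⟨ cong₂ _-_ (P′-right (suc n) (X ◃ φ)) (P′-right n (Y ◃ φ)) ⟩
  t₁ - t₂ - (t₃ - t₄)
    ≡⟨ a-b-[c-d]≡a-c-[b-d] t₁ t₂ t₃ t₄ ⟩
  t₁ - t₃ - (t₂ - t₄)
    ≡⟨ cong₂ _-_ (P′-left (φ ▹ X) (suc n)) (P′-left (φ ▹ Y) n) ⟨
  apply (φ ▹ X) (P′ (3 ℕ.+ n)) - apply (φ ▹ Y) (P′ (2 ℕ.+ n)) ∎
  where
  open ≡-Reasoning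
  t₁ = apply (X ◃ (φ ▹ X)) (P′ (2 ℕ.+ n))
  t₂ = apply (X ◃ (φ ▹ Y)) (P′ (suc n))
  t₃ = apply (Y ◃ (φ ▹ X)) (P′ (suc n))
  t₄ = apply (Y ◃ (φ ▹ Y)) (P′ n)

Q′-right : ∀ k φ → apply φ (Q′ (2 ℕ.+ k)) ≡ apply (φ ▹ X) (Q′ (suc k)) - apply (φ ▹ Y) (Q′ k)
Q′-right zero    φ = begin
  apply φ (Q′ 2)                                 ≡⟨ Q′-left φ 1 ⟩
  apply (Y ◃ φ) (P′ 2) - t₃                      ≡⟨ cong (_- t₃) (P′-right 0 (Y ◃ φ)) ⟩
  t₁ - t₂ - t₃                                   ≡⟨ a-b-c≡a-c-b t₁ t₂ t₃ ⟩
  t₁ - t₃ - t₂                                   ≡⟨ cong (_- t₂) (Q′-left (φ ▹ X) 0) ⟨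
  apply (φ ▹ X) (Q′ 1) - apply (φ ▹ Y) (Q′ 0)    ∎
  where
  open ≡-Reasoning
  t₁ = apply (Y ◃ (φ ▹ X)) (P′ 1)
  t₂ = apply (φ ▹ Y) (Q′ 0)
  t₃ = apply (Y ◃ (X ◃ φ)) (P′ 1)
Q′-right (suc k) φ = begin
  apply φ (Q′ (3 ℕ.+ k))
    ≡⟨ Q′-left φ (2 ℕ.+ k) ⟩
  apply (Y ◃ φ) (P′ (3 ℕ.+ k)) - apply (Y ◃ (X ◃ φ)) (P′ (2 ℕ.+ k))
    ≡⟨ cong₂ _-_ (P′-right (suc k) (Y ◃ φ)) (P′-right k (Y ◃ (X ◃ φ))) ⟩
  t₁ - t₂ - (t₃ - t₄)
    ≡⟨ a-b-[c-d]≡a-c-[b-d] t₁ t₂ t₃ t₄ ⟩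
  t₁ - t₃ - (t₂ - t₄)
    ≡⟨ cong₂ _-_ (Q′-left (φ ▹ X) (suc k)) (Q′-left (φ ▹ Y) k) ⟨
  apply (φ ▹ X) (Q′ (2 ℕ.+ k)) - apply (φ ▹ Y) (Q′ (suc k)) ∎
  where
  open ≡-Reasoning
  t₁ = apply (Y ◃ (φ ▹ X)) (P′ (2 ℕ.+ k))
  t₂ = apply (Y ◃ (φ ▹ Y)) (P′ (suc k))
  t₃ = apply (Y ◃ (X ◃ (φ ▹ X))) (P′ (suc k))
  t₄ = apply (Y ◃ (X ◃ (φ ▹ Y))) (P′ k)

⊛X-expansion : ∀ F₀ F₁ F₂ → (∀ φ → apply φ F₂ ≡ apply (φ ▹ X) F₁ - apply (φ ▹ Y) F₀) →
  F₁ ⊛ var X ≈ F₂ ⊕ (F₀ ⊛ var Y)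
⊛X-expansion F₀ F₁ F₂ right = mk≈ λ φ → begin
  apply φ (F₁ ⊛ var X)
    ≡⟨ apply-⊛-var φ F₁ X ⟩
  apply (φ ▹ X) F₁
    ≡⟨ a≡a-b+b _ (apply (φ ▹ Y) F₀) ⟩
  (apply (φ ▹ X) F₁ - apply (φ ▹ Y) F₀) + apply (φ ▹ Y) F₀
    ≡⟨ cong₂ _+_ (right φ) (apply-⊛-var φ F₀ Y) ⟨
  apply φ F₂ + apply φ (F₀ ⊛ var Y)
    ≡⟨ apply-++ φ F₂ (F₀ ⊛ var Y) ⟨
  apply φ (F₂ ⊕ (F₀ ⊛ var Y)) ∎
  where open ≡-Reasoning

P′-⊛X : ∀ n → P′ (suc n) ⊛ var X ≈ P′ (2 ℕ.+ n) ⊕ (P′ n ⊛ var Y)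
P′-⊛X n = ⊛X-expansion (P′ n) (P′ (suc n)) (P′ (2 ℕ.+ n)) (P′-right n)

Q′-⊛X : ∀ k → Q′ (suc k) ⊛ var X ≈ Q′ (2 ℕ.+ k) ⊕ (Q′ k ⊛ var Y)
Q′-⊛X k = ⊛X-expansion (Q′ k) (Q′ (suc k)) (Q′ (2 ℕ.+ k)) (Q′-right k)

-- The case k = -1 of Q′-⊛X, with Q₋₁ = X.
Y⊛X : var Y ⊛ var X ≈ Q′ 1 ⊕ (var X ⊛ var Y)
Y⊛X = ⊛X-expansion (var X) (var Y) (Q′ 1) (λ φ → Q′-left φ 0)

-- The basis s and the Pieri rule

data BlockView : FWord → Set where
  ones     : ∀ k → BlockView (replicate k one)
  ones-two : ∀ k {w} → BlockView w → BlockView (replicate k one ++ two ∷ w)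

blockView : ∀ w → BlockView w
blockView []        = ones 0
blockView (one ∷ w) with blockView w
... | ones k       = ones (suc k)
... | ones-two k b = ones-two (suc k) b
blockView (two ∷ w) = ones-two 0 (blockView w)

blocks-ones : ∀ k → blocks (replicate k one) ≡ k ∷ []
blocks-ones k = cong reverse (blocksLR-ones k)
  where
  blocksLR-ones : ∀ k → blocksLR (replicate k one) ≡ k ∷ []
  blocksLR-ones zero    = refl
  blocksLR-ones (suc k) rewrite blocksLR-ones k = refl

blocks-ones-two : ∀ k w → blocks (replicate k one ++ two ∷ w) ≡ blocks w ∷ʳ k
blocks-ones-two k w =
  trans (cong reverse (blocksLR-ones-two k)) (Listₚ.unfold-reverse k (blocksLR w))
  where
  blocksLR-ones-two : ∀ k → blocksLR (replicate k one ++ two ∷ w) ≡ k ∷ blocksLR w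
  blocksLR-ones-two zero    = refl
  blocksLR-ones-two (suc k) rewrite blocksLR-ones-two k = refl

blocks-nonempty : ∀ w → ∃₂ λ b bs → blocks w ≡ b ∷ bs
blocks-nonempty w = go (blockView w)
  where
  go : ∀ {w} → BlockView w → ∃₂ λ b bs → blocks w ≡ b ∷ bs
  go (ones k)               = k , [] , blocks-ones k
  go (ones-two k {w} view) with go view
  ... | b , bs , eq = b , bs ∷ʳ k , trans (blocks-ones-two k w) (cong (_∷ʳ k) eq)

sOfBlocks : List ℕ → Poly
sOfBlocks []        = 𝟙
sOfBlocks (k₀ ∷ ks) = P k₀ ⊛ prod (map Q ks)

s≡sOfBlocks : ∀ v → s v ≡ sOfBlocks (blocks v)
s≡sOfBlocks v with blocks v
... | []     = refl
... | k ∷ ks = refl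

prod-∷ʳ : ∀ ps q → prod (ps ∷ʳ q) ≈ prod ps ⊛ q
prod-∷ʳ []       q = ≈-trans (⊛-identityʳ q) (≈-sym (⊛-identityˡ q))
prod-∷ʳ (p ∷ ps) q = ≈-trans (⊛-congʳ p (prod-∷ʳ ps q)) (≈-sym (⊛-assoc p (prod ps) q))

s-ones : ∀ k → s (replicate k one) ≈ P′ k
s-ones k = begin
  s (replicate k one)    ≡⟨ trans (s≡sOfBlocks (replicate k one)) (cong sOfBlocks (blocks-ones k)) ⟩
  P k ⊛ 𝟙                ≈⟨ ⊛-identityʳ (P k) ⟩
  P k                    ≈⟨ P≈P′ k ⟩
  P′ k                   ∎
  where open ≈-Reasoning

s-ones-two : ∀ k w → s (replicate k one ++ two ∷ w) ≈ s w ⊛ Q′ k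
s-ones-two k w with blocks-nonempty w
... | b , bs , eq = begin
  s (replicate k one ++ two ∷ w)
    ≡⟨ trans (s≡sOfBlocks (replicate k one ++ two ∷ w))
             (cong sOfBlocks (trans (blocks-ones-two k w) (cong (_∷ʳ k) eq))) ⟩
  P b ⊛ prod (map Q (bs ∷ʳ k))
    ≡⟨ cong (λ qs → P b ⊛ prod qs) (Listₚ.map-++ Q bs (k ∷ [])) ⟩
  P b ⊛ prod (map Q bs ∷ʳ Q k)
    ≈⟨ ⊛-congʳ (P b) (prod-∷ʳ (map Q bs) (Q k)) ⟩
  P b ⊛ (prod (map Q bs) ⊛ Q k)
    ≈⟨ ⊛-assoc (P b) (prod (map Q bs)) (Q k) ⟨
  sOfBlocks (b ∷ bs) ⊛ Q k
    ≡⟨ cong (λ bs → sOfBlocks bs ⊛ Q k) eq ⟨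
  sOfBlocks (blocks w) ⊛ Q k
    ≡⟨ cong (_⊛ Q k) (s≡sOfBlocks w) ⟨
  s w ⊛ Q k
    ≈⟨ ⊛-congʳ (s w) (Q≈Q′ k) ⟩
  s w ⊛ Q′ k ∎
  where open ≈-Reasoning

s-two : ∀ w → s (two ∷ w) ≈ s w ⊛ var Y
s-two = s-ones-two 0

preds : FWord → List FWord
preds []        = []
preds (one ∷ w) = w ∷ []
preds (two ∷ w) = (one ∷ w) ∷ map (two ∷_) (preds w)

up : FWord → List FWord
up v = (one ∷ v) ∷ map (two ∷_) (preds v)

∑s : List FWord → Poly
∑s = concatMap s

Pieri-one : ∀ w → s (one ∷ w) ⊛ var X ≈ s (one ∷ one ∷ w) ⊕ s (two ∷ w)
Pieri-one w with blockView w
... | ones k = begin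
  s (replicate (suc k) one) ⊛ var X
    ≈⟨ ⊛-congˡ (var X) (s-ones (suc k)) ⟩
  P′ (suc k) ⊛ var X
    ≈⟨ P′-⊛X k ⟩
  P′ (2 ℕ.+ k) ⊕ (P′ k ⊛ var Y)
    ≈⟨ ⊕-cong (≈-sym (s-ones (2 ℕ.+ k))) (⊛-congˡ (var Y) (≈-sym (s-ones k))) ⟩
  s (replicate (2 ℕ.+ k) one) ⊕ (s (replicate k one) ⊛ var Y)
    ≈⟨ ⊕-cong ≈-refl (≈-sym (s-two (replicate k one))) ⟩
  s (replicate (2 ℕ.+ k) one) ⊕ s (two ∷ replicate k one) ∎
  where open ≈-Reasoning
... | ones-two k {w′} _ = begin
  s (one ∷ u k) ⊛ var X
    ≈⟨ ⊛-congˡ (var X) (s-ones-two (suc k) w′) ⟩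
  (s w′ ⊛ Q′ (suc k)) ⊛ var X
    ≈⟨ ⊛-assoc (s w′) (Q′ (suc k)) (var X) ⟩
  s w′ ⊛ (Q′ (suc k) ⊛ var X)
    ≈⟨ ⊛-congʳ (s w′) (Q′-⊛X k) ⟩
  s w′ ⊛ (Q′ (2 ℕ.+ k) ⊕ (Q′ k ⊛ var Y))
    ≈⟨ ⊛-distribˡ (s w′) (Q′ (2 ℕ.+ k)) (Q′ k ⊛ var Y) ⟩
  (s w′ ⊛ Q′ (2 ℕ.+ k)) ⊕ (s w′ ⊛ (Q′ k ⊛ var Y))
    ≈⟨ ⊕-cong (≈-sym (s-ones-two (2 ℕ.+ k) w′)) (≈-sym (⊛-assoc (s w′) (Q′ k) (var Y))) ⟩
  s (one ∷ one ∷ u k) ⊕ ((s w′ ⊛ Q′ k) ⊛ var Y)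
    ≈⟨ ⊕-cong ≈-refl (⊛-congˡ (var Y) (≈-sym (s-ones-two k w′))) ⟩
  s (one ∷ one ∷ u k) ⊕ (s (u k) ⊛ var Y)
    ≈⟨ ⊕-cong ≈-refl (≈-sym (s-two (u k))) ⟩
  s (one ∷ one ∷ u k) ⊕ s (two ∷ u k) ∎
  where
  open ≈-Reasoning
  u : ℕ → FWord
  u k = replicate k one ++ two ∷ w′

∑s-⊛Y : ∀ L → ∑s L ⊛ var Y ≈ ∑s (map (two ∷_) L)
∑s-⊛Y []      = ≈-refl
∑s-⊛Y (v ∷ L) =
  ≈-trans (≡⇒≈ (⊛-distribʳ (s v) (∑s L) (var Y))) (⊕-cong (≈-sym (s-two v)) (∑s-⊛Y L))

-- The Pieri rule s_v X = ∑_{v↗w} s_w; by succs↭up, up v lists the w with v ↗ w.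
Pieri : ∀ v → s v ⊛ var X ≈ ∑s (up v)
Pieri []        = begin
  s [] ⊛ var X              ≈⟨ ⊛-congˡ (var X) (s-ones 0) ⟩
  𝟙 ⊛ var X                 ≈⟨ ⊛-identityˡ (var X) ⟩
  var X                     ≈⟨ s-ones 1 ⟨
  s (one ∷ [])              ≡⟨ Listₚ.++-identityʳ (s (one ∷ [])) ⟨
  ∑s (up [])                ∎
  where open ≈-Reasoning
Pieri (one ∷ w) = ≈-trans (Pieri-one w) (⊕-cong ≈-refl (≡⇒≈ (sym (Listₚ.++-identityʳ (s (two ∷ w))))))
Pieri (two ∷ w) = begin
  s (two ∷ w) ⊛ var X
    ≈⟨ ⊛-congˡ (var X) (s-two w) ⟩
  (s w ⊛ var Y) ⊛ var X
    ≈⟨ ⊛-assoc (s w) (var Y) (var X) ⟩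
  s w ⊛ (var Y ⊛ var X)
    ≈⟨ ⊛-congʳ (s w) Y⊛X ⟩
  s w ⊛ (Q′ 1 ⊕ (var X ⊛ var Y))
    ≈⟨ ⊛-distribˡ (s w) (Q′ 1) (var X ⊛ var Y) ⟩
  (s w ⊛ Q′ 1) ⊕ (s w ⊛ (var X ⊛ var Y))
    ≈⟨ ⊕-cong (≈-sym (s-ones-two 1 w)) (≈-sym (⊛-assoc (s w) (var X) (var Y))) ⟩
  s (one ∷ two ∷ w) ⊕ ((s w ⊛ var X) ⊛ var Y)
    ≈⟨ ⊕-cong ≈-refl (⊛-congˡ (var Y) (Pieri w)) ⟩
  s (one ∷ two ∷ w) ⊕ (∑s (up w) ⊛ var Y)
    ≈⟨ ⊕-cong ≈-refl (∑s-⊛Y (up w)) ⟩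
  ∑s (up (two ∷ w)) ∎
  where open ≈-Reasoning

monomial : Monomial → Poly
monomial m = (1ℚ , m) ∷ []

apply-monomial : ∀ φ m → apply φ (monomial m) ≡ φ m
apply-monomial φ m = trans (ℚₚ.+-identityʳ _) (ℚₚ.*-identityˡ (φ m))

monomial-∷ : ∀ x m → monomial (x ∷ m) ≈ var x ⊛ monomial m
monomial-∷ x m = mk≈ λ φ → begin
  apply φ (monomial (x ∷ m))         ≡⟨ apply-monomial φ (x ∷ m) ⟩
  φ (x ∷ m)                          ≡⟨ apply-monomial (x ◃ φ) m ⟨
  apply (x ◃ φ) (monomial m)         ≡⟨ apply-var-⊛ φ x (monomial m) ⟨
  apply φ (var x ⊛ monomial m)       ∎
  where open ≡-Reasoning

∑s-⊛var : ∀ x L → ∃[ L′ ] (∑s L ⊛ var x ≈ ∑s L′)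
∑s-⊛var X L = concatMap up L , ⊛X L
  where
  ⊛X : ∀ L → ∑s L ⊛ var X ≈ ∑s (concatMap up L)
  ⊛X []      = ≈-refl
  ⊛X (v ∷ L) = begin
    (s v ⊕ ∑s L) ⊛ var X                 ≡⟨ ⊛-distribʳ (s v) (∑s L) (var X) ⟩
    (s v ⊛ var X) ⊕ (∑s L ⊛ var X)       ≈⟨ ⊕-cong (Pieri v) (⊛X L) ⟩
    ∑s (up v) ⊕ ∑s (concatMap up L)      ≡⟨ Listₚ.concatMap-++ s (up v) (concatMap up L) ⟨
    ∑s (concatMap up (v ∷ L))            ∎
    where open ≈-Reasoning
∑s-⊛var Y L = map (two ∷_) L , ∑s-⊛Y L

∑s-⊛monomial : ∀ m L → ∃[ L′ ] (∑s L ⊛ monomial m ≈ ∑s L′)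
∑s-⊛monomial []      L = L , ⊛-identityʳ (∑s L)
∑s-⊛monomial (x ∷ m) L with ∑s-⊛var x L
... | L₁ , e₁ with ∑s-⊛monomial m L₁
... | L₂ , e₂ = L₂ , (begin
  ∑s L ⊛ monomial (x ∷ m)            ≈⟨ ⊛-congʳ (∑s L) (monomial-∷ x m) ⟩
  ∑s L ⊛ (var x ⊛ monomial m)        ≈⟨ ⊛-assoc (∑s L) (var x) (monomial m) ⟨
  (∑s L ⊛ var x) ⊛ monomial m        ≈⟨ ⊛-congˡ (monomial m) e₁ ⟩
  ∑s L₁ ⊛ monomial m                 ≈⟨ e₂ ⟩
  ∑s L₂                              ∎)
  where open ≈-Reasoning

monomial-in-span : ∀ m → ∃[ L ] (monomial m ≈ ∑s L)
monomial-in-span m with ∑s-⊛monomial m ([] ∷ [])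
... | L , e = L , ≈-trans (≈-sym (⊛-identityˡ (monomial m)))
                         (≈-trans (⊛-congˡ (monomial m) 𝟙≈∑s[[]]) e)
  where
  𝟙≈∑s[[]] : 𝟙 ≈ ∑s ([] ∷ [])
  𝟙≈∑s[[]] = ≈-sym (≈-trans (≡⇒≈ (Listₚ.++-identityʳ (s []))) (s-ones 0))

agree-on-s⇒agree : ∀ φ χ → (∀ v → apply φ (s v) ≡ apply χ (s v)) → ∀ m → φ m ≡ χ m
agree-on-s⇒agree φ χ agree m with monomial-in-span m
... | L , e = begin
  φ m                          ≡⟨ apply-monomial φ m ⟨
  apply φ (monomial m)         ≡⟨ ≈-apply e φ ⟩
  apply φ (∑s L)               ≡⟨ apply-concatMap φ s L ⟩
  ∑ L (apply φ ∘ s)            ≡⟨ ∑-cong L agree ⟩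
  ∑ L (apply χ ∘ s)            ≡⟨ apply-concatMap χ s L ⟨
  apply χ (∑s L)               ≡⟨ ≈-apply e χ ⟨
  apply χ (monomial m)         ≡⟨ apply-monomial χ m ⟩
  χ m                          ∎
  where open ≡-Reasoning

-- Chains in the Young–Fibonacci lattice

succs↭up : ∀ v → succs v ↭ up v
succs↭up []        = ↭-refl
succs↭up (one ∷ w) = ↭-refl
succs↭up (two ∷ w) with replaceLeftmost1 w | succs↭up w
... | nothing | ih = prep _ (prep _ (↭.map⁺ (two ∷_) (↭.drop-∷ ih)))
... | just w′ | ih =
  prep _ (↭-trans (swap _ _ ↭-refl) (prep _ (↭.map⁺ (two ∷_) (↭.drop-∷ ih))))

δ : FWord → FWord → ℕ
δ = chainsOfLength 0

∑-map-vanishes : ∀ {A B : Set} (g : A → B) xs f → (∀ x → f (g x) ≡ 0) → ℕ∑.∑ (map g xs) f ≡ 0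
∑-map-vanishes g xs f z = trans (ℕ∑.∑-map g xs f) (trans (ℕ∑.∑-cong xs z) (ℕ∑.∑-zero xs))

up-preds-duality : ∀ u v → ℕ∑.∑ (up u) (λ x → δ x v) ≡ ℕ∑.∑ (preds v) (δ u)
up-preds-duality u         []        = ∑-map-vanishes (two ∷_) (preds u) _ (λ _ → refl)
up-preds-duality []        (one ∷ w) = refl
up-preds-duality (one ∷ u) (one ∷ w) = refl
up-preds-duality (two ∷ u) (one ∷ w) =
  cong (δ (two ∷ u) w ℕ.+_) (∑-map-vanishes (two ∷_) (map (two ∷_) (preds u)) _ (λ _ → refl))
up-preds-duality []        (two ∷ w) = sym (∑-map-vanishes (two ∷_) (preds w) _ (λ _ → refl))
up-preds-duality (one ∷ u) (two ∷ w) =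
  cong (δ u w ℕ.+_) (sym (∑-map-vanishes (two ∷_) (preds w) _ (λ _ → refl)))
up-preds-duality (two ∷ u) (two ∷ w) = begin
  δ (one ∷ u) w ℕ.+ ℕ∑.∑ (map (two ∷_) (map (two ∷_) (preds u))) (λ x → δ x (two ∷ w))
    ≡⟨ cong (δ (one ∷ u) w ℕ.+_) (ℕ∑.∑-map (two ∷_) (map (two ∷_) (preds u)) (λ x → δ x (two ∷ w))) ⟩
  ℕ∑.∑ (up u) (λ x → δ x w)
    ≡⟨ up-preds-duality u w ⟩
  ℕ∑.∑ (preds w) (δ u)
    ≡⟨ ℕ∑.∑-map (two ∷_) (preds w) (δ (two ∷ u)) ⟨
  ℕ∑.∑ (map (two ∷_) (preds w)) (δ (two ∷ u)) ∎
  where open ≡-Reasoning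

chains-last-step : ∀ r u v → chainsOfLength (suc r) u v ≡ ℕ∑.∑ (preds v) (chainsOfLength r u)
chains-last-step zero    u v =
  trans (sum-↭ (↭.map⁺ (λ x → δ x v) (succs↭up u))) (up-preds-duality u v)
chains-last-step (suc r) u v = begin
  ℕ∑.∑ (succs u) (λ x → chainsOfLength (suc r) x v)
    ≡⟨ ℕ∑.∑-cong (succs u) (λ x → chains-last-step r x v) ⟩
  ℕ∑.∑ (succs u) (λ x → ℕ∑.∑ (preds v) (chainsOfLength r x))
    ≡⟨ ℕ∑.∑-swap (succs u) (preds v) (chainsOfLength r) ⟩
  ℕ∑.∑ (preds v) (chainsOfLength (suc r) u) ∎
  where open ≡-Reasoning

preds-rank : ∀ v → All (λ y → suc (rank y) ≡ rank v) (preds v)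
preds-rank []        = []
preds-rank (one ∷ w) = refl ∷ []
preds-rank (two ∷ w) = refl ∷ All.map⁺ (All.map (cong (λ n → 2 ℕ.+ n)) (preds-rank w))

d′ : FWord → ℕ
d′ []        = 1
d′ (one ∷ v) = d′ v
d′ (two ∷ v) = suc (rank v) ℕ.* d′ v

mutual
  d′-preds : ∀ a w → ℕ∑.∑ (preds (a ∷ w)) d′ ≡ d′ (a ∷ w)
  d′-preds one w = ℕₚ.+-identityʳ (d′ w)
  d′-preds two w = cong (d′ w ℕ.+_) (trans (ℕ∑.∑-map (two ∷_) (preds w) d′) (d′-preds-two w))

  d′-preds-two : ∀ v → ℕ∑.∑ (preds v) (λ y → d′ (two ∷ y)) ≡ rank v ℕ.* d′ v
  d′-preds-two []      = refl
  d′-preds-two (a ∷ w) = begin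
    ℕ∑.∑ (preds (a ∷ w)) (λ y → suc (rank y) ℕ.* d′ y)
      ≡⟨ ℕ∑.∑-congᴬ (All.map (λ r → cong (ℕ._* _) r) (preds-rank (a ∷ w))) ⟩
    ℕ∑.∑ (preds (a ∷ w)) (λ y → rank (a ∷ w) ℕ.* d′ y)
      ≡⟨ ℕ∑.∑-*ˡ (preds (a ∷ w)) (rank (a ∷ w)) d′ ⟩
    rank (a ∷ w) ℕ.* ℕ∑.∑ (preds (a ∷ w)) d′
      ≡⟨ cong (rank (a ∷ w) ℕ.*_) (d′-preds a w) ⟩
    rank (a ∷ w) ℕ.* d′ (a ∷ w) ∎
    where open ≡-Reasoning

d≡d′ : ∀ v → d v ≡ d′ v
d≡d′ v = chains-from-[] (rank v) v refl
  where
  chains-from-[] : ∀ n v → rank v ≡ n → chainsOfLength n [] v ≡ d′ v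
  chains-from-[] zero    []        _  = refl
  chains-from-[] zero    (one ∷ w) ()
  chains-from-[] zero    (two ∷ w) ()
  chains-from-[] (suc n) []        ()
  chains-from-[] (suc n) (a ∷ w)   eq = begin
    chainsOfLength (suc n) [] (a ∷ w)
      ≡⟨ chains-last-step n [] (a ∷ w) ⟩
    ℕ∑.∑ (preds (a ∷ w)) (chainsOfLength n [])
      ≡⟨ ℕ∑.∑-congᴬ (All.map (λ {y} r → chains-from-[] n y (ℕₚ.suc-injective (trans r eq)))
                             (preds-rank (a ∷ w))) ⟩
    ℕ∑.∑ (preds (a ∷ w)) d′
      ≡⟨ d′-preds a w ⟩
    d′ (a ∷ w) ∎
    where open ≡-Reasoning

infix 8 _/1+_
_/1+_ : ℕ → ℕ → ℚ
a /1+ b = ℤ.+ a ℚ./ suc b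

/≡/1+ : ∀ a n .{{_ : NonZero n}} → ℤ.+ a ℚ./ n ≡ a /1+ ℕ.pred n
/≡/1+ a (suc n) = refl

/1+-cross : ∀ a b c e → a ℕ.* suc e ≡ c ℕ.* suc b → a /1+ b ≡ c /1+ e
/1+-cross a b c e eq = ℚₚ.fromℚᵘ-cong {mkℚᵘ (ℤ.+ a) b} {mkℚᵘ (ℤ.+ c) e}
  (*≡* (trans (sym (ℤₚ.pos-* a (suc e))) (trans (cong ℤ.+_ eq) (ℤₚ.pos-* c (suc b)))))

private
  toℚᵘ-/1+ : ∀ a b → ℚ.toℚᵘ (a /1+ b) ≃ᵘ mkℚᵘ (ℤ.+ a) b
  toℚᵘ-/1+ a b = ℚₚ.toℚᵘ-fromℚᵘ (mkℚᵘ (ℤ.+ a) b)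

-- (b + 1)(e + 1) = (e + b (e + 1)) + 1
/1+-* : ∀ a b c e → a /1+ b * c /1+ e ≡ (a ℕ.* c) /1+ (e ℕ.+ b ℕ.* suc e)
/1+-* a b c e = ℚₚ.toℚᵘ-injective (begin
  ℚ.toℚᵘ (a /1+ b * c /1+ e)
    ≈⟨ ℚₚ.toℚᵘ-homo-* (a /1+ b) (c /1+ e) ⟩
  ℚ.toℚᵘ (a /1+ b) ℚᵘ.* ℚ.toℚᵘ (c /1+ e)
    ≈⟨ ℚᵘₚ.*-cong (toℚᵘ-/1+ a b) (toℚᵘ-/1+ c e) ⟩
  mkℚᵘ (ℤ.+ a ℤ.* ℤ.+ c) e′
    ≡⟨ cong (λ n → mkℚᵘ n e′) (ℤₚ.pos-* a c) ⟨
  mkℚᵘ (ℤ.+ (a ℕ.* c)) e′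
    ≈⟨ toℚᵘ-/1+ (a ℕ.* c) e′ ⟨
  ℚ.toℚᵘ ((a ℕ.* c) /1+ e′) ∎)
  where
  open ℚᵘₚ.≃-Reasoning
  e′ = e ℕ.+ b ℕ.* suc e

/1+-+ : ∀ a c b → a /1+ b + c /1+ b ≡ (a ℕ.+ c) /1+ b
/1+-+ a c b = trans sum (/1+-cross n b′ (a ℕ.+ c) b (same-denominator a c b))
  where
  n  = a ℕ.* suc b ℕ.+ c ℕ.* suc b
  b′ = b ℕ.+ b ℕ.* suc b
  sum : a /1+ b + c /1+ b ≡ n /1+ b′
  sum = ℚₚ.toℚᵘ-injective (begin
    ℚ.toℚᵘ (a /1+ b + c /1+ b)
      ≈⟨ ℚₚ.toℚᵘ-homo-+ (a /1+ b) (c /1+ b) ⟩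
    ℚ.toℚᵘ (a /1+ b) ℚᵘ.+ ℚ.toℚᵘ (c /1+ b)
      ≈⟨ ℚᵘₚ.+-cong (toℚᵘ-/1+ a b) (toℚᵘ-/1+ c b) ⟩
    mkℚᵘ (ℤ.+ a ℤ.* ℤ.+ suc b ℤ.+ ℤ.+ c ℤ.* ℤ.+ suc b) b′
      ≡⟨ cong (λ z → mkℚᵘ z b′) numerator ⟨
    mkℚᵘ (ℤ.+ n) b′
      ≈⟨ toℚᵘ-/1+ n b′ ⟨
    ℚ.toℚᵘ (n /1+ b′) ∎)
    where
    open ℚᵘₚ.≃-Reasoning
    numerator : ℤ.+ n ≡ ℤ.+ a ℤ.* ℤ.+ suc b ℤ.+ ℤ.+ c ℤ.* ℤ.+ suc b
    numerator = trans (ℤₚ.pos-+ (a ℕ.* suc b) (c ℕ.* suc b))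
                      (cong₂ ℤ._+_ (ℤₚ.pos-* a (suc b)) (ℤₚ.pos-* c (suc b)))
  same-denominator : ∀ a c b → (a ℕ.* suc b ℕ.+ c ℕ.* suc b) ℕ.* suc b
                             ≡ (a ℕ.+ c) ℕ.* suc (b ℕ.+ b ℕ.* suc b)
  same-denominator = solve-∀

∑-/1+ : ∀ {A : Set} xs (f : A → ℕ) b → ∑ xs (λ x → f x /1+ b) ≡ ℕ∑.∑ xs f /1+ b
∑-/1+ []       f b = /1+-cross 0 0 0 b refl
∑-/1+ (x ∷ xs) f b = trans (cong (λ q → f x /1+ b + q) (∑-/1+ xs f b)) (/1+-+ (f x) (ℕ∑.∑ xs f) b)

fact-pred : ∀ r → suc (ℕ.pred (r !)) ≡ r !
fact-pred r = ℕₚ.suc-pred (r !) {{r ℕₚ.!≢0}}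

dOverFact≡ : ∀ v → dOverFact v ≡ d′ v /1+ ℕ.pred (rank v !)
dOverFact≡ v = trans (cong (λ n → ℚ._/_ (ℤ.+ n) (rank v !) {{rank v ℕₚ.!≢0}}) (d≡d′ v))
                     (/≡/1+ (d′ v) (rank v !) {{rank v ℕₚ.!≢0}})

dOverFact-two : ∀ w → dOverFact (two ∷ w) ≡ dOverFact w * 1 /1+ suc (rank w)
dOverFact-two w = begin
  dOverFact (two ∷ w)                          ≡⟨ dOverFact≡ (two ∷ w) ⟩
  (suc r ℕ.* D) /1+ ℕ.pred ((2 ℕ.+ r) !)       ≡⟨ /1+-cross (suc r ℕ.* D) _ (D ℕ.* 1) (suc r ℕ.+ f ℕ.* suc (suc r)) cross ⟩
  (D ℕ.* 1) /1+ (suc r ℕ.+ f ℕ.* suc (suc r))  ≡⟨ /1+-* D f 1 (suc r) ⟨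
  D /1+ f * 1 /1+ suc r                        ≡⟨ cong (_* 1 /1+ suc r) (dOverFact≡ w) ⟨
  dOverFact w * 1 /1+ suc r                    ∎
  where
  open ≡-Reasoning
  r = rank w
  D = d′ w
  f = ℕ.pred (r !)
  arithmetic : ∀ r D f → suc r ℕ.* D ℕ.* suc (suc r ℕ.+ f ℕ.* suc (suc r))
                       ≡ D ℕ.* 1 ℕ.* (suc (suc r) ℕ.* (suc r ℕ.* suc f))
  arithmetic = solve-∀
  cross : suc r ℕ.* D ℕ.* suc (suc r ℕ.+ f ℕ.* suc (suc r)) ≡ D ℕ.* 1 ℕ.* suc (ℕ.pred ((2 ℕ.+ r) !))
  cross = trans (arithmetic r D f)
    (trans (cong (λ F → D ℕ.* 1 ℕ.* (suc (suc r) ℕ.* (suc r ℕ.* F))) (fact-pred r))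
           (cong (D ℕ.* 1 ℕ.*_) (sym (fact-pred (2 ℕ.+ r)))))

-- The values d(v)/|v|! are harmonic for the Pieri rule.
dOverFact-up : ∀ w → dOverFact (one ∷ w) + ∑ (preds w) (λ y → dOverFact (two ∷ y)) ≡ dOverFact w
dOverFact-up w = begin
  dOverFact (one ∷ w) + ∑ (preds w) (λ y → dOverFact (two ∷ y))
    ≡⟨ cong₂ _+_ (dOverFact≡ (one ∷ w)) (∑-congᴬ (All.map (λ {y} → same-rank y) (preds-rank w))) ⟩
  D /1+ f₁ + ∑ (preds w) (λ y → d′ (two ∷ y) /1+ f₁)
    ≡⟨ cong (λ q → D /1+ f₁ + q) (∑-/1+ (preds w) (λ y → d′ (two ∷ y)) f₁) ⟩
  D /1+ f₁ + ℕ∑.∑ (preds w) (λ y → d′ (two ∷ y)) /1+ f₁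
    ≡⟨ cong (λ n → D /1+ f₁ + n /1+ f₁) (d′-preds-two w) ⟩
  D /1+ f₁ + (r ℕ.* D) /1+ f₁
    ≡⟨ /1+-+ D (r ℕ.* D) f₁ ⟩
  (suc r ℕ.* D) /1+ f₁
    ≡⟨ /1+-cross (suc r ℕ.* D) f₁ D (ℕ.pred (r !)) cancel ⟩
  D /1+ ℕ.pred (r !)
    ≡⟨ dOverFact≡ w ⟨
  dOverFact w ∎
  where
  open ≡-Reasoning
  r = rank w
  D = d′ w
  f₁ = ℕ.pred (suc r !)
  same-rank : ∀ y → suc (rank y) ≡ r → dOverFact (two ∷ y) ≡ d′ (two ∷ y) /1+ f₁
  same-rank y eq = trans (dOverFact≡ (two ∷ y)) (cong (λ n → d′ (two ∷ y) /1+ ℕ.pred (suc n !)) eq)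
  arithmetic : ∀ r D F → suc r ℕ.* D ℕ.* F ≡ D ℕ.* (suc r ℕ.* F)
  arithmetic = solve-∀
  cancel : suc r ℕ.* D ℕ.* suc (ℕ.pred (r !)) ≡ D ℕ.* suc f₁
  cancel = trans (cong (suc r ℕ.* D ℕ.*_) (fact-pred r))
                 (trans (arithmetic r D (r !)) (cong (D ℕ.*_) (sym (fact-pred (suc r)))))

deg : Monomial → ℕ
deg []      = 0
deg (X ∷ m) = suc (deg m)
deg (Y ∷ m) = 2 ℕ.+ deg m

deg-++ : ∀ m n → deg (m ++ n) ≡ deg m ℕ.+ deg n
deg-++ []      n = refl
deg-++ (X ∷ m) n = cong suc (deg-++ m n)
deg-++ (Y ∷ m) n = cong (2 ℕ.+_) (deg-++ m n)

Homogeneous : ℕ → Poly → Set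
Homogeneous n p = ∀ φ χ → (∀ m → deg m ≡ n → φ m ≡ χ m) → apply φ p ≡ apply χ p

homogeneous-≈ : ∀ {n p q} → p ≈ q → Homogeneous n p → Homogeneous n q
homogeneous-≈ e hp φ χ agree = trans (sym (≈-apply e φ)) (trans (hp φ χ agree) (≈-apply e χ))

homogeneous-⊝ : ∀ {n} p q → Homogeneous n p → Homogeneous n q → Homogeneous n (p ⊝ q)
homogeneous-⊝ p q hp hq φ χ agree =
  trans (apply-⊝ φ p q) (trans (cong₂ _-_ (hp φ χ agree) (hq φ χ agree)) (sym (apply-⊝ χ p q)))

homogeneous-⊛ : ∀ {a b} p q → Homogeneous a p → Homogeneous b q → Homogeneous (a ℕ.+ b) (p ⊛ q)
homogeneous-⊛ p q hp hq φ χ agree =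
  trans (apply-⊛ φ p q) (trans (hp (φ ⋊ q) (χ ⋊ q) agree-⋊) (sym (apply-⊛ χ p q)))
  where
  agree-⋊ : ∀ m → deg m ≡ _ → (φ ⋊ q) m ≡ (χ ⋊ q) m
  agree-⋊ m dm = hq (λ n → φ (m ++ n)) (λ n → χ (m ++ n))
    (λ n dn → agree (m ++ n) (trans (deg-++ m n) (cong₂ ℕ._+_ dm dn)))

homogeneous-𝟙 : Homogeneous 0 𝟙
homogeneous-𝟙 φ χ agree = cong (λ z → 1ℚ * z + 0ℚ) (agree [] refl)

homogeneous-var : ∀ x → Homogeneous (deg (x ∷ [])) (var x)
homogeneous-var x φ χ agree = cong (λ z → 1ℚ * z + 0ℚ) (agree (x ∷ []) refl)

P′-homogeneous : ∀ n → Homogeneous n (P′ n)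
P′-homogeneous zero          = homogeneous-𝟙
P′-homogeneous (suc zero)    = homogeneous-var X
P′-homogeneous (suc (suc n)) = homogeneous-⊝ (var X ⊛ P′ (suc n)) (var Y ⊛ P′ n)
  (homogeneous-⊛ (var X) (P′ (suc n)) (homogeneous-var X) (P′-homogeneous (suc n)))
  (homogeneous-⊛ (var Y) (P′ n) (homogeneous-var Y) (P′-homogeneous n))

Q′-homogeneous : ∀ k → Homogeneous (2 ℕ.+ k) (Q′ k)
Q′-homogeneous zero    = homogeneous-var Y
Q′-homogeneous (suc k) = homogeneous-⊝ (var Y ⊛ P′ (suc k)) (var X ⊛ (var Y ⊛ P′ k))
  (homogeneous-⊛ (var Y) (P′ (suc k)) (homogeneous-var Y) (P′-homogeneous (suc k)))
  (homogeneous-⊛ (var X) (var Y ⊛ P′ k) (homogeneous-var X)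
    (homogeneous-⊛ (var Y) (P′ k) (homogeneous-var Y) (P′-homogeneous k)))

rank-ones : ∀ k → rank (replicate k one) ≡ k
rank-ones zero    = refl
rank-ones (suc k) = cong suc (rank-ones k)

rank-ones-two : ∀ k w → rank (replicate k one ++ two ∷ w) ≡ rank w ℕ.+ (2 ℕ.+ k)
rank-ones-two k w = trans (ones-++ k) (arithmetic k (rank w))
  where
  arithmetic : ∀ k r → k ℕ.+ (2 ℕ.+ r) ≡ r ℕ.+ (2 ℕ.+ k)
  arithmetic = solve-∀
  ones-++ : ∀ k → rank (replicate k one ++ two ∷ w) ≡ k ℕ.+ (2 ℕ.+ rank w)
  ones-++ zero    = refl
  ones-++ (suc k) = cong suc (ones-++ k)

s-homogeneous : ∀ v → Homogeneous (rank v) (s v)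
s-homogeneous v = go (blockView v)
  where
  go : ∀ {v} → BlockView v → Homogeneous (rank v) (s v)
  go (ones k) = subst (λ n → Homogeneous n (s (replicate k one))) (sym (rank-ones k))
    (homogeneous-≈ (≈-sym (s-ones k)) (P′-homogeneous k))
  go (ones-two k {w} view) =
    subst (λ n → Homogeneous n (s (replicate k one ++ two ∷ w))) (sym (rank-ones-two k w))
      (homogeneous-≈ (≈-sym (s-ones-two k w)) (homogeneous-⊛ (s w) (Q′ k) (go view) (Q′-homogeneous k)))

-- The functional φP

-- φP-from c m = φP(u m) / φP(u) for any monomial u of degree c.
φP-from : ℕ → LinearFunctional
φP-from c []      = 1ℚ
φP-from c (X ∷ m) = φP-from (suc c) m
φP-from c (Y ∷ m) = 1 /1+ suc c * φP-from (2 ℕ.+ c) m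

φP : LinearFunctional
φP = φP-from 0

φP-from-++ : ∀ c m n → φP-from c (m ++ n) ≡ φP-from c m * φP-from (c ℕ.+ deg m) n
φP-from-++ c []      n = sym (trans (ℚₚ.*-identityˡ _) (cong (λ i → φP-from i n) (ℕₚ.+-identityʳ c)))
φP-from-++ c (X ∷ m) n = trans (φP-from-++ (suc c) m n)
  (cong (λ i → φP-from (suc c) m * φP-from i n) (sym (ℕₚ.+-suc c (deg m))))
φP-from-++ c (Y ∷ m) n = begin
  1 /1+ suc c * φP-from (2 ℕ.+ c) (m ++ n)
    ≡⟨ cong (1 /1+ suc c *_) (φP-from-++ (2 ℕ.+ c) m n) ⟩
  1 /1+ suc c * (φP-from (2 ℕ.+ c) m * φP-from (2 ℕ.+ c ℕ.+ deg m) n)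
    ≡⟨ ℚₚ.*-assoc (1 /1+ suc c) _ _ ⟨
  1 /1+ suc c * φP-from (2 ℕ.+ c) m * φP-from (2 ℕ.+ c ℕ.+ deg m) n
    ≡⟨ cong (λ i → 1 /1+ suc c * φP-from (2 ℕ.+ c) m * φP-from i n) (arithmetic c (deg m)) ⟩
  1 /1+ suc c * φP-from (2 ℕ.+ c) m * φP-from (c ℕ.+ (2 ℕ.+ deg m)) n ∎
  where
  open ≡-Reasoning
  arithmetic : ∀ c d → 2 ℕ.+ c ℕ.+ d ≡ c ℕ.+ (2 ℕ.+ d)
  arithmetic = solve-∀

φP-⊛X : ∀ p → apply φP (p ⊛ var X) ≡ apply φP p
φP-⊛X p = trans (apply-⊛-var φP p X)
  (apply-cong (λ m → trans (φP-from-++ 0 m (X ∷ [])) (ℚₚ.*-identityʳ (φP m))) p)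

φP-⊛Y : ∀ n p → Homogeneous n p → apply φP (p ⊛ var Y) ≡ apply φP p * 1 /1+ suc n
φP-⊛Y n p hp = begin
  apply φP (p ⊛ var Y)                     ≡⟨ apply-⊛-var φP p Y ⟩
  apply (φP ▹ Y) p                         ≡⟨ hp (φP ▹ Y) (λ m → 1 /1+ suc n * φP m) agree ⟩
  apply (λ m → 1 /1+ suc n * φP m) p       ≡⟨ apply-*ˡ φP (1 /1+ suc n) p ⟩
  1 /1+ suc n * apply φP p                 ≡⟨ ℚₚ.*-comm (1 /1+ suc n) (apply φP p) ⟩
  apply φP p * 1 /1+ suc n                 ∎
  where
  open ≡-Reasoning
  agree : ∀ m → deg m ≡ n → (φP ▹ Y) m ≡ 1 /1+ suc n * φP m
  agree m refl = begin
    φP (m ++ Y ∷ [])                    ≡⟨ φP-from-++ 0 m (Y ∷ []) ⟩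
    φP m * (1 /1+ suc (deg m) * 1ℚ)     ≡⟨ cong (φP m *_) (ℚₚ.*-identityʳ (1 /1+ suc (deg m))) ⟩
    φP m * 1 /1+ suc (deg m)            ≡⟨ ℚₚ.*-comm (φP m) _ ⟩
    1 /1+ suc (deg m) * φP m            ∎

φP-s-two : ∀ w → apply φP (s w) ≡ dOverFact w → apply φP (s (two ∷ w)) ≡ dOverFact (two ∷ w)
φP-s-two w φP-s-w = begin
  apply φP (s (two ∷ w))                  ≡⟨ ≈-apply (s-two w) φP ⟩
  apply φP (s w ⊛ var Y)                  ≡⟨ φP-⊛Y (rank w) (s w) (s-homogeneous w) ⟩
  apply φP (s w) * 1 /1+ suc (rank w)     ≡⟨ cong (_* 1 /1+ suc (rank w)) φP-s-w ⟩
  dOverFact w * 1 /1+ suc (rank w)        ≡⟨ dOverFact-two w ⟨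
  dOverFact (two ∷ w)                     ∎
  where open ≡-Reasoning

φP-s-one : ∀ w → apply φP (s w) ≡ dOverFact w →
  All (λ y → apply φP (s (two ∷ y)) ≡ dOverFact (two ∷ y)) (preds w) →
  apply φP (s (one ∷ w)) ≡ dOverFact (one ∷ w)
φP-s-one w φP-s-w φP-s-preds = +-cancelʳ _ _ _ (begin
  apply φP (s (one ∷ w)) + ∑ (preds w) (λ y → apply φP (s (two ∷ y)))
    ≡⟨ cong (λ q → apply φP (s (one ∷ w)) + q) (∑-map (two ∷_) (preds w) (apply φP ∘ s)) ⟨
  apply φP (s (one ∷ w)) + ∑ (map (two ∷_) (preds w)) (apply φP ∘ s)
    ≡⟨ apply-concatMap φP s (up w) ⟨
  apply φP (∑s (up w))
    ≡⟨ ≈-apply (Pieri w) φP ⟨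
  apply φP (s w ⊛ var X)
    ≡⟨ φP-⊛X (s w) ⟩
  apply φP (s w)
    ≡⟨ φP-s-w ⟩
  dOverFact w
    ≡⟨ dOverFact-up w ⟨
  dOverFact (one ∷ w) + ∑ (preds w) (λ y → dOverFact (two ∷ y))
    ≡⟨ cong (λ q → dOverFact (one ∷ w) + q) (∑-congᴬ (All.map sym φP-s-preds)) ⟩
  dOverFact (one ∷ w) + ∑ (preds w) (λ y → apply φP (s (two ∷ y))) ∎)
  where open ≡-Reasoning

φP-s : ∀ v → apply φP (s v) ≡ dOverFact v
φP-s v = bounded (rank v) v ℕₚ.≤-refl
  where
  bounded : ∀ n v → rank v ≤ n → apply φP (s v) ≡ dOverFact v
  bounded _       []        _            = refl
  bounded (suc n) (two ∷ w) (s≤s 1+w≤n) = φP-s-two w (bounded n w (ℕₚ.<⇒≤ 1+w≤n))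
  bounded (suc n) (one ∷ w) (s≤s w≤n)   =
    φP-s-one w (bounded n w w≤n) (All.map bounded-two (preds-rank w))
    where
    bounded-two : ∀ {y} → suc (rank y) ≡ rank w → apply φP (s (two ∷ y)) ≡ dOverFact (two ∷ y)
    bounded-two {y} eq = φP-s-two y (bounded n y (ℕₚ.<⇒≤ (subst (_≤ n) (sym eq) w≤n)))

apply-Xpow : ∀ φ j → apply φ (var X ^^ j) ≡ φ (replicate j X)
apply-Xpow φ zero    = apply-𝟙 φ
apply-Xpow φ (suc j) = trans (apply-var-⊛ φ X (var X ^^ j)) (apply-Xpow (X ◃ φ) j)

φP-from-Xs : ∀ j c n → φP-from c (replicate j X ++ n) ≡ φP-from (c ℕ.+ j) n
φP-from-Xs zero    c n = cong (λ i → φP-from i n) (sym (ℕₚ.+-identityʳ c))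
φP-from-Xs (suc j) c n = trans (φP-from-Xs j (suc c) n) (cong (λ i → φP-from i n) (sym (ℕₚ.+-suc c j)))

-- X^{k+2} and (k+2) X^k Y take the same value under φP(_ · h).
φP-pFactor : ∀ k h → apply φP (pFactor k ⊛ h) ≡ 0ℚ
φP-pFactor k h = begin
  apply φP (pFactor k ⊛ h)                          ≡⟨ apply-⊛ φP (pFactor k) h ⟩
  apply ψ (pFactor k)                               ≡⟨ apply-⊝ ψ Xᵏ⁺² (c · XᵏY) ⟩
  apply ψ Xᵏ⁺² - apply ψ (c · XᵏY)                  ≡⟨ cong (λ z → apply ψ Xᵏ⁺² - z) (apply-· ψ c XᵏY) ⟩
  apply ψ Xᵏ⁺² - c * apply ψ XᵏY                    ≡⟨ cong₂ (λ a b → a - c * b) ψ-Xᵏ⁺² ψ-XᵏY ⟩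
  A - c * (w * A)                                   ≡⟨ cong (λ z → A - z) (ℚₚ.*-assoc c w A) ⟨
  A - c * w * A                                     ≡⟨ cong (λ z → A - z * A) c*w≡1 ⟩
  A - 1ℚ * A                                        ≡⟨ cong (λ z → A - z) (ℚₚ.*-identityˡ A) ⟩
  A - A                                             ≡⟨ ℚₚ.+-inverseʳ A ⟩
  0ℚ                                                ∎
  where
  open ≡-Reasoning
  ψ = φP ⋊ h
  c = (2 ℕ.+ k) /1+ 0
  w = 1 /1+ suc k
  A = apply (φP-from (2 ℕ.+ k)) h
  Xᵏ⁺² = var X ^^ (2 ℕ.+ k)
  XᵏY = (var X ^^ k) ⊛ var Y
  ψ-Xᵏ⁺² : apply ψ Xᵏ⁺² ≡ A
  ψ-Xᵏ⁺² = trans (apply-Xpow ψ (2 ℕ.+ k)) (apply-cong (φP-from-Xs (2 ℕ.+ k) 0) h)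
  ψ-XᵏY : apply ψ XᵏY ≡ w * A
  ψ-XᵏY = begin
    apply ψ XᵏY                                          ≡⟨ apply-⊛-var ψ (var X ^^ k) Y ⟩
    apply (ψ ▹ Y) (var X ^^ k)                           ≡⟨ apply-Xpow (ψ ▹ Y) k ⟩
    apply (λ n → φP ((replicate k X ++ Y ∷ []) ++ n)) h  ≡⟨ apply-cong XᵏY-n h ⟩
    apply (λ n → w * φP-from (2 ℕ.+ k) n) h              ≡⟨ apply-*ˡ (φP-from (2 ℕ.+ k)) w h ⟩
    w * A                                                ∎
    where
    XᵏY-n : ∀ n → φP ((replicate k X ++ Y ∷ []) ++ n) ≡ w * φP-from (2 ℕ.+ k) n
    XᵏY-n n = trans (cong φP (Listₚ.++-assoc (replicate k X) (Y ∷ []) n)) (φP-from-Xs k 0 (Y ∷ n))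
  arithmetic : ∀ k → (2 ℕ.+ k) ℕ.* 1 ℕ.* 1 ≡ 1 ℕ.* suc (suc k ℕ.+ 0 ℕ.* suc (suc k))
  arithmetic = solve-∀
  c*w≡1 : c * w ≡ 1ℚ
  c*w≡1 = trans (/1+-* (2 ℕ.+ k) 0 1 (suc k))
                (/1+-cross ((2 ℕ.+ k) ℕ.* 1) (suc k ℕ.+ 0 ℕ.* suc (suc k)) 1 0 (arithmetic k))

¬Has2-ones : ∀ k → ¬ Has2 (replicate k one)
¬Has2-ones zero    ()
¬Has2-ones (suc k) has2 = ¬Has2-ones k has2

pFrom-∷-∷ʳ : ∀ b bs k → pFrom (b ∷ (bs ∷ʳ k)) ≡ pFactor b ⊛ pFrom (bs ∷ʳ k)
pFrom-∷-∷ʳ b []       k = refl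
pFrom-∷-∷ʳ b (c ∷ cs) k = refl

p-factor : ∀ u → Has2 u → ∃₂ λ k h → p u ≡ pFactor k ⊛ h
p-factor u has2 with blockView u
... | ones k = ⊥-elim (¬Has2-ones k has2)
... | ones-two k {w} _ with blocks-nonempty w
...   | b , bs , eq = b , pFrom (bs ∷ʳ k) ,
        trans (cong pFrom (trans (blocks-ones-two k w) (cong (_∷ʳ k) eq))) (pFrom-∷-∷ʳ b bs k)

proposition7p1 : (φ : LinearFunctional)
    → (∀ (v : FWord) → apply φ (s v) ≡ dOverFact v)
    → ∀ (u : FWord) → Has2 u → apply φ (p u) ≡ 0ℚ
proposition7p1 φ hyp u has2 with p-factor u has2
... | k , h , eq = begin
  apply φ (p u)              ≡⟨ cong (apply φ) eq ⟩
  apply φ (pFactor k ⊛ h)    ≡⟨ apply-cong φ≗φP (pFactor k ⊛ h) ⟩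
  apply φP (pFactor k ⊛ h)   ≡⟨ φP-pFactor k h ⟩
  0ℚ                         ∎
  where
  open ≡-Reasoning
  φ≗φP : ∀ m → φ m ≡ φP m
  φ≗φP = agree-on-s⇒agree φ φP (λ v → trans (hyp v) (sym (φP-s v)))
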